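{- Let $d=4$ and let $h,g$ be distinct $4$-uniform hypergraphs on the same vertex set with $\mathrm{Proj}(h)=\mathrm{Proj}(g)$ and $e(h)\ge e(g)$. Then $d-1-\frac{1}{m(h)}\ge\frac{2d-4}{2d-1}=\frac47$.
   Context: $\mathrm{Proj}(H)$ is the graph on the vertex set of $H$ with $\{i,j\}$ an edge iff some hyperedge contains $\{i,j\}$. $e(\cdot)$ and $v(\cdot)$ are numbers of hyperedges and vertices; $m(H)=\max_{K\subseteq H} e(K)/v(K)$ over subhypergraphs $K$ of $H$. -}

module Defs where

open import Data.Bool using (Bool; true; false; if_then_else_)
open import Data.Nat using (ℕ; zero; suc; NonZero)
open import Data.Fin using (Fin)
open import Data.Fin.Subset using (Subset; _∈_; _⊆_; ∣_∣)
open import Data.Vec using (_∷_; [])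
open import Data.List using (List; []; _∷_; map; _++_)
open import Data.Nat.ListAction using (sum)
open import Data.Product using (Σ; _×_; ∃; _,_)
open import Data.Integer using (+_)
open import Data.Rational using (ℚ; _/_; _≤_)
open import Relation.Binary.PropositionalEquality using (_≡_; _≢_)
open import Function.Bundles using (_⇔_)

-- A hypergraph on vertex set Fin n: the characteristic function of its
-- set of hyperedges (each hyperedge a subset of Fin n).
Hypergraph : ℕ → Set
Hypergraph n = Subset n → Bool

Uniform : ∀ {n} → ℕ → Hypergraph n → Set
Uniform k H = ∀ S → H S ≡ true → ∣ S ∣ ≡ k

allSubsets : ∀ n → List (Subset n)
allSubsets zero = [] ∷ []
allSubsets (suc n) = map (true ∷_) (allSubsets n) ++ map (false ∷_) (allSubsets n)

e : ∀ {n} → Hypergraph n → ℕ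
e {n} H = sum (map (λ S → if H S then 1 else 0) (allSubsets n))

ProjEdge : ∀ {n} → Hypergraph n → Fin n → Fin n → Set
ProjEdge H i j = i ≢ j × ∃ λ S → H S ≡ true × i ∈ S × j ∈ S

SameProj : ∀ {n} → Hypergraph n → Hypergraph n → Set
SameProj {n} h g = ∀ (i j : Fin n) → ProjEdge h i j ⇔ ProjEdge g i j

record SubHypergraph {n} (H : Hypergraph n) : Set where
  field
    U : Subset n
    F : Hypergraph n
    U-nonempty : NonZero ∣ U ∣
    F⊆H : ∀ S → F S ≡ true → H S ≡ true
    F-in-U : ∀ S → F S ≡ true → S ⊆ U

density : ∀ {n} {H : Hypergraph n} → SubHypergraph H → ℚ
density K = _/_ (+ e F) ∣ U ∣ {{U-nonempty}}
  where open SubHypergraph K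

IsMaxDensity : ∀ {n} → Hypergraph n → ℚ → Set
IsMaxDensity H q = (Σ (SubHypergraph H) λ K → density K ≡ q)
                 × (∀ (K : SubHypergraph H) → density K ≤ q)

{-# OPTIONS --safe #-}
module Submission where

-- Write A = h∖g, B = g∖h and C = h∩g; A is nonempty and e(B) ≤ e(A).  It suffices to find a
-- subhypergraph K of h with 7 v(K) ≤ 17 e(K), since then 3 − 1/m(h) ≥ 3 − 17/7 = 4/7.
-- Call a pair of vertices one-sided if some edge of A or of B contains it, but not edges of
-- both.  As Proj h = Proj g, every one-sided pair lies in an edge of C, and K consists of A
-- together with one such C-edge for every one-sided pair.  We discharge with a demand of 168
-- per vertex and a supply of 408 per edge of K (408/168 = 17/7).  A C-edge of K pays 168 for
-- each of its vertices not lying on A ∪ B, and for each ordered one-sided pair charged to it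
-- 34 if all 12 ordered pairs of its vertices are charged to it, 36 otherwise.  Each A- and
-- B-edge pays 51 to each of its vertices, affordable since e(A) + e(B) ≤ 2 e(A).  A vertex
-- of degree one in A ∪ B (a leaf) has three one-sided partners but may still lack 9, which
-- the other vertices of its edge cover by giving 3, 9 or 27 to an edge with 1, 2 or 3 leaves.
-- B is restricted to the edges of g∖h meeting an edge of A, so that each of them has a
-- non-leaf.  The scheme fails only when an A-edge consists of four leaves; then that edge
-- with the C-edges covering its six pairs is already dense enough.

-- A separate module, so that _≤_ and _/_ at top level are those of ℚ, as in the statement.
module Combinatorics where

  open import Algebra.Properties.CommutativeSemigroup using (interchange)
  open import Data.Bool using (Bool; true; false; _∧_; _∨_; not; _xor_; if_then_else_)
  import Data.Bool as Bool
  open import Data.Bool.Properties using (∧-conicalˡ; ∧-conicalʳ; ∨-zeroʳ; not-injective)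
  open import Data.Empty using (⊥-elim)
  open import Data.Maybe using (fromMaybe)
  open import Data.Fin using (Fin; zero; suc; _≟_)
  open import Data.Fin.Subset using (Subset; ∣_∣; _∈_; _⊆_; ⊥)
  open import Data.List using (List; []; _∷_; map; _++_; allFin; findᵇ)
  open import Data.List.Properties using (map-∘; map-++; map-tabulate)
  open import Data.Nat using (ℕ; zero; suc; _+_; _*_; _≤_; _<_; z≤n; s≤s; _<ᵇ_; _≤?_; NonZero; >-nonZero)
  open import Data.Nat.ListAction using (sum)
  open import Data.Nat.ListAction.Properties using (sum-++)
  open import Data.Nat.Properties hiding (_≟_)
  open import Data.Product using (Σ; _×_; ∃; _,_; proj₁; proj₂)
  open import Data.Sum using (_⊎_; inj₁; inj₂)
  open import Data.Unit using (tt)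
  open import Data.Vec using (lookup; tabulate; _∷_; [])
  open import Data.Vec.Properties using ([]=⇒lookup; lookup⇒[]=; lookup∘tabulate; tabulate∘lookup; tabulate-cong; ≡-dec)
  open import Function using (_∘_)
  open import Function.Bundles using (Equivalence)
  open import Relation.Binary.Definitions using (DecidableEquality)
  open import Relation.Binary.PropositionalEquality
  open import Relation.Nullary using (does; yes; no; contradiction)
  open import Relation.Nullary.Decidable using (dec-true; dec-false)

  open import Defs

  -- Finite sums

  𝟙 : Bool → ℕ
  𝟙 b = if b then 1 else 0

  ∑ : {A : Set} → List A → (A → ℕ) → ℕ
  ∑ xs f = sum (map f xs)

  -- For closed m and n the second argument is tt.
  refute-≤ : ∀ {m n} → m ≤ n → Bool.T (n <ᵇ m) → ∀ {X : Set} → X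
  refute-≤ {m} {n} m≤n n<m = ⊥-elim (<⇒≱ (<ᵇ⇒< n m n<m) m≤n)

  true≢false : ∀ {b} → b ≡ true → b ≡ false → ∀ {X : Set} → X
  true≢false refl ()

  ∨-true⁻ : ∀ {a b} → a ∨ b ≡ true → a ≡ true ⊎ b ≡ true
  ∨-true⁻ {true}  _ = inj₁ refl
  ∨-true⁻ {false} p = inj₂ p

  ∧-true⁺ : ∀ {a b} → a ≡ true → b ≡ true → a ∧ b ≡ true
  ∧-true⁺ refl refl = refl

  𝟙≤1 : ∀ b → 𝟙 b ≤ 1
  𝟙≤1 true  = ≤-refl
  𝟙≤1 false = z≤n

  𝟙-∧ : ∀ a b → 𝟙 (a ∧ b) ≡ 𝟙 a * 𝟙 b
  𝟙-∧ true  b = sym (+-identityʳ (𝟙 b))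
  𝟙-∧ false b = refl

  𝟙-∧≤ : ∀ a b → 𝟙 (a ∧ b) ≤ 𝟙 a
  𝟙-∧≤ true  b = 𝟙≤1 b
  𝟙-∧≤ false b = z≤n

  𝟙-positive : ∀ {b} → 1 ≤ 𝟙 b → b ≡ true
  𝟙-positive {true} _ = refl

  𝟙-true : ∀ {b} → b ≡ true → 𝟙 b ≡ 1
  𝟙-true refl = refl

  private variable
    A B : Set
    n k : ℕ

  ∑-cong : ∀ xs {f g : A → ℕ} → (∀ a → f a ≡ g a) → ∑ xs f ≡ ∑ xs g
  ∑-cong []       f≗g = refl
  ∑-cong (x ∷ xs) f≗g = cong₂ _+_ (f≗g x) (∑-cong xs f≗g)

  ∑-mono : ∀ xs {f g : A → ℕ} → (∀ a → f a ≤ g a) → ∑ xs f ≤ ∑ xs g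
  ∑-mono []       f≤g = z≤n
  ∑-mono (x ∷ xs) f≤g = +-mono-≤ (f≤g x) (∑-mono xs f≤g)

  ∑-+ : ∀ xs (f g : A → ℕ) → ∑ xs (λ a → f a + g a) ≡ ∑ xs f + ∑ xs g
  ∑-+ []       f g = refl
  ∑-+ (x ∷ xs) f g = trans (cong (f x + g x +_) (∑-+ xs f g))
                           (interchange +-commutativeSemigroup (f x) (g x) (∑ xs f) (∑ xs g))

  ∑-*ˡ : ∀ xs c (f : A → ℕ) → ∑ xs (λ a → c * f a) ≡ c * ∑ xs f
  ∑-*ˡ []       c f = sym (*-zeroʳ c)
  ∑-*ˡ (x ∷ xs) c f = trans (cong (c * f x +_) (∑-*ˡ xs c f)) (sym (*-distribˡ-+ c (f x) _))

  ∑-*ʳ : ∀ xs (f : A → ℕ) c → ∑ xs (λ a → f a * c) ≡ ∑ xs f * c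
  ∑-*ʳ xs f c = trans (∑-cong xs (λ a → *-comm (f a) c)) (trans (∑-*ˡ xs c f) (*-comm c _))

  ∑-zero : ∀ xs → ∑ xs (λ (_ : A) → 0) ≡ 0
  ∑-zero []       = refl
  ∑-zero (x ∷ xs) = ∑-zero xs

  ∑-comm : ∀ xs (ys : List B) (f : A → B → ℕ) →
           ∑ xs (λ a → ∑ ys (f a)) ≡ ∑ ys (λ b → ∑ xs (λ a → f a b))
  ∑-comm []       ys f = sym (∑-zero ys)
  ∑-comm (x ∷ xs) ys f = trans (cong (∑ ys (f x) +_) (∑-comm xs ys f))
                               (sym (∑-+ ys (f x) (λ b → ∑ xs (λ a → f a b))))

  ∑-map : ∀ xs (g : A → B) (f : B → ℕ) → ∑ (map g xs) f ≡ ∑ xs (f ∘ g)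
  ∑-map xs g f = cong sum (sym (map-∘ xs))

  ∑-++ : ∀ xs ys (f : A → ℕ) → ∑ (xs ++ ys) f ≡ ∑ xs f + ∑ ys f
  ∑-++ xs ys f = trans (cong sum (map-++ f xs ys)) (sum-++ (map f xs) (map f ys))

  ∑-positive : ∀ xs (f : A → ℕ) → 1 ≤ ∑ xs f → ∃ λ a → 1 ≤ f a
  ∑-positive (x ∷ xs) f pos with f x in fx
  ... | suc _ = x , subst (1 ≤_) (sym fx) (s≤s z≤n)
  ... | zero  = ∑-positive xs f pos

  ∑𝟙-positive⇒∃ : ∀ xs (p : A → Bool) → 1 ≤ ∑ xs (𝟙 ∘ p) → ∃ λ a → p a ≡ true
  ∑𝟙-positive⇒∃ xs p pos with ∑-positive xs (𝟙 ∘ p) pos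
  ... | a , 1≤ = a , 𝟙-positive 1≤

  module Enumeration {A : Set} (xs : List A) (_≟ₐ_ : DecidableEquality A)
    (once : ∀ b → ∑ xs (λ a → 𝟙 (does (a ≟ₐ b))) ≡ 1) where

    ∑-pick : ∀ (f : A → ℕ) b → ∑ xs (λ a → 𝟙 (does (a ≟ₐ b)) * f a) ≡ f b
    ∑-pick f b = begin
        ∑ xs (λ a → 𝟙 (does (a ≟ₐ b)) * f a)   ≡⟨ ∑-cong xs at-b ⟩
        ∑ xs (λ a → 𝟙 (does (a ≟ₐ b)) * f b)   ≡⟨ ∑-*ʳ xs _ (f b) ⟩
        ∑ xs (λ a → 𝟙 (does (a ≟ₐ b))) * f b   ≡⟨ cong (_* f b) (once b) ⟩
        1 * f b                           ≡⟨ *-identityˡ (f b) ⟩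
        f b                               ∎
      where
      open ≡-Reasoning
      at-b : ∀ a → 𝟙 (does (a ≟ₐ b)) * f a ≡ 𝟙 (does (a ≟ₐ b)) * f b
      at-b a with a ≟ₐ b
      ... | yes refl = refl
      ... | no  _    = refl

    term≤∑ : ∀ (f : A → ℕ) b → f b ≤ ∑ xs f
    term≤∑ f b = subst (_≤ ∑ xs f) (∑-pick f b) (∑-mono xs below)
      where
      below : ∀ a → 𝟙 (does (a ≟ₐ b)) * f a ≤ f a
      below a = ≤-trans (*-monoˡ-≤ (f a) (𝟙≤1 (does (a ≟ₐ b)))) (≤-reflexive (*-identityˡ (f a)))

    1≤∑𝟙 : ∀ (p : A → Bool) {b} → p b ≡ true → 1 ≤ ∑ xs (𝟙 ∘ p)
    1≤∑𝟙 p {b} pb = subst (_≤ ∑ xs (𝟙 ∘ p)) (𝟙-true pb) (term≤∑ (𝟙 ∘ p) b)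

    ∑-mono-< : ∀ (f g : A → ℕ) b → (∀ a → f a ≤ g a) → f b < g b → suc (∑ xs f) ≤ ∑ xs g
    ∑-mono-< f g b f≤g fb<gb =
      subst (_≤ ∑ xs g) (trans (∑-+ xs _ f) (cong (_+ ∑ xs f) (once b))) (∑-mono xs bump)
      where
      bump : ∀ a → 𝟙 (does (a ≟ₐ b)) + f a ≤ g a
      bump a with a ≟ₐ b
      ... | yes refl = fb<gb
      ... | no  _    = f≤g a

    2≤∑ : ∀ (f : A → ℕ) {b c} → b ≢ c → 1 ≤ f b → 1 ≤ f c → 2 ≤ ∑ xs f
    2≤∑ f {b} {c} b≢c fb fc =
      subst (_≤ ∑ xs f) (trans (∑-+ xs _ _) (cong₂ _+_ (once b) (once c))) (∑-mono xs two)
      where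
      two : ∀ a → 𝟙 (does (a ≟ₐ b)) + 𝟙 (does (a ≟ₐ c)) ≤ f a
      two a with a ≟ₐ b | a ≟ₐ c
      ... | yes refl | yes refl = contradiction refl b≢c
      ... | yes refl | no  _    = fb
      ... | no  _    | yes refl = fc
      ... | no  _    | no  _    = z≤n

    ∃-second : ∀ (f : A → ℕ) → (∀ a → f a ≤ 1) → 2 ≤ ∑ xs f → ∀ b → ∃ λ a → a ≢ b × 1 ≤ f a
    ∃-second f f≤1 2≤∑f b with ∑-positive xs (λ a → 𝟙 (not (does (a ≟ₐ b))) * f a) rest
      where
      split : ∀ a → f a ≡ 𝟙 (does (a ≟ₐ b)) * f a + 𝟙 (not (does (a ≟ₐ b))) * f a
      split a with a ≟ₐ b
      ... | yes _ = sym (trans (+-identityʳ (f a + 0)) (+-identityʳ (f a)))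
      ... | no  _ = sym (+-identityʳ (f a))
      others : ℕ
      others = ∑ xs (λ a → 𝟙 (not (does (a ≟ₐ b))) * f a)
      rest : 1 ≤ others
      rest = +-cancelˡ-≤ 1 1 others (begin
        2                                                 ≤⟨ 2≤∑f ⟩
        ∑ xs f                                            ≡⟨ ∑-cong xs split ⟩
        ∑ xs (λ a → 𝟙 (does (a ≟ₐ b)) * f a + _)               ≡⟨ ∑-+ xs _ _ ⟩
        ∑ xs (λ a → 𝟙 (does (a ≟ₐ b)) * f a) + others          ≡⟨ cong (_+ others) (∑-pick f b) ⟩
        f b + others                                      ≤⟨ +-monoˡ-≤ others (f≤1 b) ⟩
        1 + others                                        ∎)
        where open ≤-Reasoning
    ... | a , pos with a ≟ₐ b
    ...   | no a≢b = a , a≢b , subst (1 ≤_) (+-identityʳ (f a)) pos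

  -- Subsets of Fin n

  ∑-allFin-suc : (f : Fin (suc n) → ℕ) → ∑ (allFin (suc n)) f ≡ f zero + ∑ (allFin n) (f ∘ suc)
  ∑-allFin-suc f = cong (λ ys → f zero + sum ys)
    (trans (map-tabulate suc f) (sym (map-tabulate (λ i → i) (f ∘ suc))))

  allFin-once : ∀ {n} (b : Fin n) → ∑ (allFin n) (λ a → 𝟙 (does (a ≟ b))) ≡ 1
  allFin-once {suc n} zero    = trans (∑-allFin-suc {n} (λ a → 𝟙 (does (a ≟ zero)))) (cong suc (∑-zero (allFin n)))
  allFin-once {suc n} (suc b) = trans (∑-allFin-suc {n} (λ a → 𝟙 (does (a ≟ suc b)))) (allFin-once {n} b)

  _≟ₛ_ : ∀ {n} → DecidableEquality (Subset n)
  _≟ₛ_ = ≡-dec Bool._≟_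

  ∑-allSubsets-suc : ∀ {n} (f : Subset (suc n) → ℕ) →
    ∑ (allSubsets (suc n)) f ≡ ∑ (allSubsets n) (f ∘ (true ∷_)) + ∑ (allSubsets n) (f ∘ (false ∷_))
  ∑-allSubsets-suc {n} f = trans (∑-++ (map (true ∷_) (allSubsets n)) _ f)
    (cong₂ _+_ (∑-map (allSubsets n) (true ∷_) f) (∑-map (allSubsets n) (false ∷_) f))

  allSubsets-once : ∀ {n} (T : Subset n) → ∑ (allSubsets n) (λ S → 𝟙 (does (S ≟ₛ T))) ≡ 1
  allSubsets-once {zero}  []         = refl
  allSubsets-once {suc n} (true ∷ T) =
    trans (∑-allSubsets-suc (λ S → 𝟙 (does (S ≟ₛ (true ∷ T))))) (cong₂ _+_ (allSubsets-once T) (∑-zero (allSubsets n)))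
  allSubsets-once {suc n} (false ∷ T) =
    trans (∑-allSubsets-suc (λ S → 𝟙 (does (S ≟ₛ (false ∷ T))))) (cong₂ _+_ (∑-zero (allSubsets n)) (allSubsets-once T))

  module Vertices {n} = Enumeration (allFin n) _≟_ allFin-once
  module Subsets {n} = Enumeration (allSubsets n) _≟ₛ_ allSubsets-once

  _∈ᵇ_ : Fin n → Subset n → Bool
  x ∈ᵇ S = lookup S x

  ∑ᵥ : (Fin n → ℕ) → ℕ
  ∑ᵥ {n} = ∑ (allFin n)

  ∑ₛ : (Subset n → ℕ) → ℕ
  ∑ₛ {n} = ∑ (allSubsets n)

  size : Subset n → ℕ
  size S = ∑ᵥ (λ x → 𝟙 (x ∈ᵇ S))

  ∣∣≡size : (S : Subset n) → ∣ S ∣ ≡ size S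
  ∣∣≡size []          = refl
  ∣∣≡size (true ∷ S)  = trans (cong suc (∣∣≡size S)) (sym (∑-allFin-suc (λ x → 𝟙 (x ∈ᵇ (true ∷ S)))))
  ∣∣≡size (false ∷ S) = trans (∣∣≡size S) (sym (∑-allFin-suc (λ x → 𝟙 (x ∈ᵇ (false ∷ S)))))

  ∈⇒∈ᵇ : {x : Fin n} {S : Subset n} → x ∈ S → x ∈ᵇ S ≡ true
  ∈⇒∈ᵇ = []=⇒lookup

  ∈ᵇ⇒∈ : {x : Fin n} {S : Subset n} → x ∈ᵇ S ≡ true → x ∈ S
  ∈ᵇ⇒∈ {x = x} {S} = lookup⇒[]= x S

  ∈ᵇ-ext : {S T : Subset n} → (∀ x → x ∈ᵇ S ≡ x ∈ᵇ T) → S ≡ T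
  ∈ᵇ-ext {S = S} {T} S≗T = trans (sym (tabulate∘lookup S)) (trans (tabulate-cong S≗T) (tabulate∘lookup T))

  ⊆∧size≥⇒≡ : {S T : Subset n} → (∀ x → x ∈ᵇ S ≡ true → x ∈ᵇ T ≡ true) → size T ≤ size S → S ≡ T
  ⊆∧size≥⇒≡ {S = S} {T} S⊆T ∣T∣≤∣S∣ = ∈ᵇ-ext same
    where
    same : ∀ x → x ∈ᵇ S ≡ x ∈ᵇ T
    same x with x ∈ᵇ S in x∈S | x ∈ᵇ T in x∈T
    ... | true  | true  = refl
    ... | false | false = refl
    ... | true  | false = true≢false (S⊆T x x∈S) x∈T
    ... | false | true  =
      ⊥-elim (<⇒≱ (Vertices.∑-mono-< (λ y → 𝟙 (y ∈ᵇ S)) (λ y → 𝟙 (y ∈ᵇ T)) x pointwise strict) ∣T∣≤∣S∣)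
      where
      pointwise : ∀ y → 𝟙 (y ∈ᵇ S) ≤ 𝟙 (y ∈ᵇ T)
      pointwise y with y ∈ᵇ S in y∈S
      ... | true  rewrite S⊆T y y∈S = ≤-refl
      ... | false = z≤n
      strict : 𝟙 (x ∈ᵇ S) < 𝟙 (x ∈ᵇ T)
      strict rewrite x∈S | x∈T = s≤s z≤n

  size-without : {S : Subset n} {x : Fin n} → x ∈ᵇ S ≡ true →
                 suc (∑ᵥ (λ z → 𝟙 (z ∈ᵇ S ∧ not (does (z ≟ x))))) ≡ size S
  size-without {n} {S} {x} x∈S = begin
    suc (∑ᵥ rest)                                   ≡⟨ cong (_+ ∑ᵥ rest) (sym (allFin-once x)) ⟩
    ∑ᵥ (λ z → 𝟙 (does (z ≟ x))) + ∑ᵥ rest           ≡⟨ sym (∑-+ (allFin n) _ rest) ⟩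
    ∑ᵥ (λ z → 𝟙 (does (z ≟ x)) + rest z)            ≡⟨ ∑-cong (allFin n) split ⟩
    size S                                          ∎
    where
    open ≡-Reasoning
    rest : Fin n → ℕ
    rest z = 𝟙 (z ∈ᵇ S ∧ not (does (z ≟ x)))
    split : ∀ z → 𝟙 (does (z ≟ x)) + rest z ≡ 𝟙 (z ∈ᵇ S)
    split z with z ≟ x
    ... | yes refl rewrite x∈S = refl
    ... | no  _ with z ∈ᵇ S
    ...   | true  = refl
    ...   | false = refl

  size-others : {S : Subset n} {x : Fin n} (P : Fin n → Bool) → size S ≡ suc k → x ∈ᵇ S ≡ true →
                (∀ z → z ∈ᵇ S ≡ true → z ≢ x → P z ≡ true) → k ≤ ∑ᵥ (𝟙 ∘ P)
  size-others {n} {S = S} {x} P ∣S∣ x∈S others =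
    subst (_≤ ∑ᵥ (𝟙 ∘ P)) (suc-injective (trans (size-without {S = S} {x} x∈S) ∣S∣)) (∑-mono (allFin n) pointwise)
    where
    pointwise : ∀ z → 𝟙 (z ∈ᵇ S ∧ not (does (z ≟ x))) ≤ 𝟙 (P z)
    pointwise z with z ∈ᵇ S in z∈S | z ≟ x
    ... | true  | no z≢x rewrite others z z∈S z≢x = ≤-refl
    ... | true  | yes _ = z≤n
    ... | false | _     = z≤n

  ∃-other : {S : Subset n} {x : Fin n} → size S ≡ suc (suc k) → x ∈ᵇ S ≡ true →
            ∃ λ z → z ∈ᵇ S ≡ true × z ≢ x
  ∃-other {n} {S = S} {x} ∣S∣ x∈S
    with ∑-positive (allFin n) (λ z → 𝟙 (z ∈ᵇ S ∧ not (does (z ≟ x))))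
           (subst (1 ≤_) (sym (suc-injective (trans (size-without {S = S} {x} x∈S) ∣S∣))) (s≤s z≤n))
  ... | z , pos with z ∈ᵇ S in z∈S | z ≟ x
  ...   | true | no z≢x = z , z∈S , z≢x

  ∃-∈ᵇ : {S : Subset n} → 1 ≤ size S → ∃ λ x → x ∈ᵇ S ≡ true
  ∃-∈ᵇ {n} {S} = ∑𝟙-positive⇒∃ (allFin n) (_∈ᵇ S)

  ∃-∖ : {S T : Subset n} → size S ≤ size T → S ≢ T → ∃ λ z → z ∈ᵇ T ≡ true × z ∈ᵇ S ≡ false
  ∃-∖ {n} {S} {T} ∣S∣≤∣T∣ S≢T with ∑ᵥ (λ z → 𝟙 (z ∈ᵇ T ∧ not (z ∈ᵇ S))) in count
  ... | suc _ with ∑𝟙-positive⇒∃ (allFin n) (λ z → z ∈ᵇ T ∧ not (z ∈ᵇ S)) (subst (1 ≤_) (sym count) (s≤s z≤n))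
  ...   | z , p = z , ∧-conicalˡ (z ∈ᵇ T) _ p , not-injective (∧-conicalʳ (z ∈ᵇ T) _ p)
  ∃-∖ {n} {S} {T} ∣S∣≤∣T∣ S≢T | zero = contradiction (sym (⊆∧size≥⇒≡ T⊆S ∣S∣≤∣T∣)) S≢T
    where
    T⊆S : ∀ x → x ∈ᵇ T ≡ true → x ∈ᵇ S ≡ true
    T⊆S x x∈T with x ∈ᵇ S in x∈S
    ... | true  = refl
    ... | false = refute-≤ (subst (1 ≤_) count
                    (Vertices.1≤∑𝟙 (λ z → z ∈ᵇ T ∧ not (z ∈ᵇ S)) (∧-true⁺ x∈T (cong not x∈S)))) tt

  1≤e : (X : Hypergraph n) {S : Subset n} → X S ≡ true → 1 ≤ e X
  1≤e X = Subsets.1≤∑𝟙 X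

  positive : ℕ → Bool
  positive zero    = false
  positive (suc _) = true

  positive⁺ : ∀ {k} → 1 ≤ k → positive k ≡ true
  positive⁺ {suc _} _ = refl

  positive⁻ : ∀ {k} → positive k ≡ true → 1 ≤ k
  positive⁻ {suc _} _ = s≤s z≤n

  ¬positive⇒≡0 : ∀ {k} → positive k ≡ false → k ≡ 0
  ¬positive⇒≡0 {zero} _ = refl

  someSubset : (Subset n → Bool) → Bool
  someSubset p = positive (∑ₛ (𝟙 ∘ p))

  someSubset⁺ : (p : Subset n → Bool) (S : Subset n) → p S ≡ true → someSubset p ≡ true
  someSubset⁺ p S pS = positive⁺ (Subsets.1≤∑𝟙 p pS)

  someSubset⁻ : (p : Subset n → Bool) → someSubset p ≡ true → ∃ λ S → p S ≡ true
  someSubset⁻ {n} p some = ∑𝟙-positive⇒∃ (allSubsets n) p (positive⁻ some)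

  someVertex : (Fin n → Bool) → Bool
  someVertex p = positive (∑ᵥ (𝟙 ∘ p))

  someVertex⁺ : (p : Fin n → Bool) (x : Fin n) → p x ≡ true → someVertex p ≡ true
  someVertex⁺ p x px = positive⁺ (Vertices.1≤∑𝟙 p px)

  someVertex⁻ : (p : Fin n → Bool) → someVertex p ≡ true → ∃ λ x → p x ≡ true
  someVertex⁻ {n} p some = ∑𝟙-positive⇒∃ (allFin n) p (positive⁻ some)

  choose : (Subset n → Bool) → Subset n
  choose {n} p = fromMaybe ⊥ (findᵇ p (allSubsets n))

  choose-spec : (p : Subset n → Bool) → someSubset p ≡ true → p (choose p) ≡ true
  choose-spec {n} p some = first (allSubsets n) (positive⁻ some)
    where
    first : ∀ xs → 1 ≤ ∑ xs (𝟙 ∘ p) → p (fromMaybe ⊥ (findᵇ p xs)) ≡ true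
    first (S ∷ Ss) pos with p S in pS
    ... | true  = pS
    ... | false = first Ss pos

  -- Discharging weights

  full : ℕ → Bool
  full 12 = true
  full _  = false

  full⇒≡12 : ∀ {m} → full m ≡ true → m ≡ 12
  full⇒≡12 {12} _ = refl

  price : ℕ → ℕ
  price m = if full m then 34 else 36

  price≤36 : ∀ m → price m ≤ 36
  price≤36 m with full m
  ... | true  = m≤n+m 34 2
  ... | false = ≤-refl

  34≤price : ∀ m → 34 ≤ price m
  34≤price m with full m
  ... | true  = ≤-refl
  ... | false = m≤m+n 34 2

  -- A C-edge with k vertices on A ∪ B, o further vertices, and m ≤ k (k − 1) pairs charged to it.
  used-edge-budget : ∀ k o m → k + o ≡ 4 → m + k ≤ k * k → 1 ≤ m → 168 * o + m * price m ≤ 408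
  used-edge-budget 0 o m _ m≤ 1≤m = refute-≤ (≤-trans 1≤m (≤-trans (m≤m+n m 0) m≤)) tt
  used-edge-budget 1 o m _ m≤ 1≤m = refute-≤ (≤-trans (+-monoˡ-≤ 1 1≤m) m≤) tt
  used-edge-budget 2 2 m refl m≤ _ =
    +-monoʳ-≤ 336 (≤-trans (*-monoʳ-≤ m (price≤36 m)) (*-monoˡ-≤ 36 (+-cancelʳ-≤ 2 m 2 m≤)))
  used-edge-budget 3 1 m refl m≤ _ =
    ≤-trans (+-monoʳ-≤ 168 (≤-trans (*-monoʳ-≤ m (price≤36 m)) (*-monoˡ-≤ 36 (+-cancelʳ-≤ 3 m 6 m≤)))) (m≤m+n 384 24)
  used-edge-budget 4 0 m refl m≤ _ with full m in fm
  ... | true  rewrite full⇒≡12 fm = ≤-refl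
  ... | false = ≤-trans (*-monoˡ-≤ 36 m≤11) (m≤m+n 396 12)
    where
    m≤11 : m ≤ 11
    m≤11 with m≤n⇒m<n∨m≡n (+-cancelʳ-≤ 4 m 12 m≤)
    ... | inj₁ m<12 = ≤-pred m<12
    ... | inj₂ refl = true≢false refl fm
  used-edge-budget (suc (suc (suc (suc (suc _))))) _ _ () _ _
  used-edge-budget 2 0 _ () _ _
  used-edge-budget 2 1 _ () _ _
  used-edge-budget 2 (suc (suc (suc _))) _ () _ _
  used-edge-budget 3 0 _ () _ _
  used-edge-budget 3 (suc (suc _)) _ () _ _
  used-edge-budget 4 (suc _) _ () _ _

  isOne : ℕ → Bool
  isOne 1 = true
  isOne _ = false

  isOne⇒≡1 : ∀ {d} → isOne d ≡ true → d ≡ 1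
  isOne⇒≡1 {1} _ = refl

  *𝟙isOne≡𝟙isOne : ∀ d → d * 𝟙 (isOne d) ≡ 𝟙 (isOne d)
  *𝟙isOne≡𝟙isOne 0 = refl
  *𝟙isOne≡𝟙isOne 1 = refl
  *𝟙isOne≡𝟙isOne (suc (suc d)) = *-zeroʳ (suc (suc d))

  *𝟙isOne≤1 : ∀ d → d * 𝟙 (isOne d) ≤ 1
  *𝟙isOne≤1 d = ≤-trans (≤-reflexive (*𝟙isOne≡𝟙isOne d)) (𝟙≤1 (isOne d))

  2≤⇒¬isOne : ∀ {d} → 2 ≤ d → isOne d ≡ false
  2≤⇒¬isOne {suc (suc _)} _ = refl
  2≤⇒¬isOne {1} (s≤s ())

  atLeastTwo : ℕ → Bool
  atLeastTwo (suc (suc _)) = true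
  atLeastTwo _             = false

  gift : ℕ → ℕ
  gift 0 = 0
  gift 1 = 3
  gift 2 = 9
  gift _ = 27

  gift≤9* : ∀ j → gift j ≤ 9 * j
  gift≤9* 0 = z≤n
  gift≤9* 1 = m≤m+n 3 6
  gift≤9* 2 = m≤m+n 9 9
  gift≤9* (suc (suc (suc j))) = ≤-trans (m≤m+n 27 (9 * j)) (≤-reflexive (sym (*-distribˡ-+ 9 3 j)))

  gift≤3 : ∀ j → j ≤ 1 → gift j ≤ 3
  gift≤3 0 _ = z≤n
  gift≤3 1 _ = ≤-refl
  gift≤3 (suc (suc _)) (s≤s ())

  leaf-budget : ∀ j G → j + G ≡ 4 → j ≤ 3 → 9 * j ≤ G * gift j
  leaf-budget 0 G _ _ = z≤n
  leaf-budget 1 3 refl _ = ≤-refl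
  leaf-budget 2 2 refl _ = ≤-refl
  leaf-budget 3 1 refl _ = ≤-refl
  leaf-budget (suc (suc (suc (suc _)))) _ _ (s≤s (s≤s (s≤s ())))

  -- The trailing + 0 is the bonus 9 · 𝟙 (leaf x) of a non-leaf.
  hub-budget : ∀ {d R C q} → 168 ≤ 51 * d + 25 * q → R ≤ 9 * q → 34 * q ≤ C → 168 + R ≤ 51 * d + C + 0
  hub-budget {d} {R} {C} {q} base R≤9q 34q≤C = begin
    168 + R                    ≤⟨ +-mono-≤ base R≤9q ⟩
    51 * d + 25 * q + 9 * q    ≡⟨ +-assoc (51 * d) _ _ ⟩
    51 * d + (25 * q + 9 * q)  ≡⟨ cong (51 * d +_) (sym (*-distribʳ-+ q 25 9)) ⟩
    51 * d + 34 * q            ≤⟨ +-monoʳ-≤ (51 * d) 34q≤C ⟩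
    51 * d + C                 ≡⟨ sym (+-identityʳ _) ⟩
    51 * d + C + 0             ∎
    where open ≤-Reasoning

  module TwoHypergraphs {n : ℕ} (h g : Hypergraph n) (h-uniform : Uniform 4 h) (g-uniform : Uniform 4 g) where

    onlyH onlyG both : Subset n → Bool
    onlyH S = h S ∧ not (g S)
    onlyG S = g S ∧ not (h S)
    both  S = h S ∧ g S

    size-h : ∀ {S} → h S ≡ true → size S ≡ 4
    size-h {S} hS = trans (sym (∣∣≡size S)) (h-uniform S hS)

    size-g : ∀ {S} → g S ≡ true → size S ≡ 4
    size-g {S} gS = trans (sym (∣∣≡size S)) (g-uniform S gS)

    DenseSubhypergraph : Set
    DenseSubhypergraph = Σ (SubHypergraph h) λ K → 7 * ∣ SubHypergraph.U K ∣ ≤ 17 * e (SubHypergraph.F K)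

    module Discharging (A B : Subset n → Bool)
      (A⊆onlyH : ∀ {S} → A S ≡ true → onlyH S ≡ true)
      (B⊆onlyG : ∀ {S} → B S ≡ true → onlyG S ≡ true) where

      E : Subset n → Bool
      E S = A S ∨ B S

      degIn : (Subset n → Bool) → Fin n → ℕ
      degIn X x = ∑ₛ (λ S → 𝟙 (X S ∧ x ∈ᵇ S))

      deg : Fin n → ℕ
      deg = degIn E

      touched : Fin n → Bool
      touched x = positive (deg x)

      joins : (Subset n → Bool) → Fin n → Fin n → Bool
      joins X x y = someSubset (λ S → X S ∧ (x ∈ᵇ S ∧ y ∈ᵇ S))

      oneSided : Fin n → Fin n → Bool
      oneSided x y = not (does (x ≟ y)) ∧ (joins A x y xor joins B x y)

      coversPair : Fin n → Fin n → Subset n → Bool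
      coversPair x y S = both S ∧ (x ∈ᵇ S ∧ y ∈ᵇ S)

      A⇒h : ∀ {S} → A S ≡ true → h S ≡ true
      A⇒h a = ∧-conicalˡ _ _ (A⊆onlyH a)

      A⇒¬g : ∀ {S} → A S ≡ true → g S ≡ false
      A⇒¬g a = not-injective (∧-conicalʳ _ _ (A⊆onlyH a))

      B⇒g : ∀ {S} → B S ≡ true → g S ≡ true
      B⇒g b = ∧-conicalˡ _ _ (B⊆onlyG b)

      B⇒¬h : ∀ {S} → B S ≡ true → h S ≡ false
      B⇒¬h b = not-injective (∧-conicalʳ _ _ (B⊆onlyG b))

      A-B-disjoint : ∀ {S} → A S ≡ true → B S ≡ true → ∀ {X : Set} → X
      A-B-disjoint a b = true≢false (B⇒g b) (A⇒¬g a)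

      E-both-disjoint : ∀ {S} → E S ≡ true → both S ≡ true → ∀ {X : Set} → X
      E-both-disjoint {S} e c with ∨-true⁻ {A S} e
      ... | inj₁ a = true≢false (∧-conicalʳ _ _ c) (A⇒¬g a)
      ... | inj₂ b = true≢false (∧-conicalˡ _ _ c) (B⇒¬h b)

      A⇒E : ∀ {S} → A S ≡ true → E S ≡ true
      A⇒E {S} a = cong (_∨ B S) a

      B⇒E : ∀ {S} → B S ≡ true → E S ≡ true
      B⇒E {S} b = trans (cong (A S ∨_) b) (∨-zeroʳ (A S))

      size-E : ∀ {S} → E S ≡ true → size S ≡ 4
      size-E {S} e with ∨-true⁻ {A S} e
      ... | inj₁ a = size-h (A⇒h a)
      ... | inj₂ b = size-g (B⇒g b)

      size-both : ∀ {S} → both S ≡ true → size S ≡ 4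
      size-both c = size-h (∧-conicalˡ _ _ c)

      deg≡degA+degB : ∀ x → deg x ≡ degIn A x + degIn B x
      deg≡degA+degB x = trans (∑-cong (allSubsets n) split) (∑-+ (allSubsets n) _ _)
        where
        split : ∀ S → 𝟙 (E S ∧ x ∈ᵇ S) ≡ 𝟙 (A S ∧ x ∈ᵇ S) + 𝟙 (B S ∧ x ∈ᵇ S)
        split S with A S in a | B S in b
        ... | true  | true  = A-B-disjoint a b
        ... | true  | false = sym (+-identityʳ _)
        ... | false | _     = refl

      1≤degIn : ∀ X {S} x → X S ≡ true → x ∈ᵇ S ≡ true → 1 ≤ degIn X x
      1≤degIn X {S} x XS x∈S =
        Subsets.1≤∑𝟙 (λ S → X S ∧ x ∈ᵇ S) (∧-true⁺ XS x∈S)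

      E⇒touched : ∀ {S} x → E S ≡ true → x ∈ᵇ S ≡ true → touched x ≡ true
      E⇒touched x e x∈S = positive⁺ (1≤degIn E x e x∈S)

      joins⁻ : ∀ X x y → joins X x y ≡ true → ∃ λ S → X S ≡ true × x ∈ᵇ S ≡ true × y ∈ᵇ S ≡ true
      joins⁻ X x y j with someSubset⁻ (λ S → X S ∧ (x ∈ᵇ S ∧ y ∈ᵇ S)) j
      ... | S , p = S , ∧-conicalˡ (X S) _ p , ∧-conicalˡ (x ∈ᵇ S) _ x∧y , ∧-conicalʳ (x ∈ᵇ S) _ x∧y
        where x∧y = ∧-conicalʳ (X S) _ p

      joins⁺ : ∀ X {x y} S → X S ≡ true → x ∈ᵇ S ≡ true → y ∈ᵇ S ≡ true → joins X x y ≡ true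
      joins⁺ X {x} {y} S XS x∈S y∈S = someSubset⁺ (λ S → X S ∧ (x ∈ᵇ S ∧ y ∈ᵇ S)) S (∧-true⁺ XS (∧-true⁺ x∈S y∈S))

      oneSided⇒≢ : ∀ {x y} → oneSided x y ≡ true → x ≢ y
      oneSided⇒≢ {x} {y} q x≡y = true≢false (dec-true (x ≟ y) x≡y) (not-injective (∧-conicalˡ _ _ q))

      oneSided⁻ : ∀ {x y} → oneSided x y ≡ true →
                  (joins A x y ≡ true × joins B x y ≡ false) ⊎ (joins A x y ≡ false × joins B x y ≡ true)
      oneSided⁻ {x} {y} q with joins A x y | joins B x y | ∧-conicalʳ (not (does (x ≟ y))) _ q
      ... | true  | false | _ = inj₁ (refl , refl)
      ... | false | true  | _ = inj₂ (refl , refl)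

      oneSided⁺ : ∀ {x y} → x ≢ y → joins A x y xor joins B x y ≡ true → oneSided x y ≡ true
      oneSided⁺ {x} {y} x≢y xor rewrite dec-false (x ≟ y) x≢y = xor

      oneSided⇒E : ∀ {x y} → oneSided x y ≡ true → ∃ λ S → E S ≡ true × x ∈ᵇ S ≡ true × y ∈ᵇ S ≡ true
      oneSided⇒E {x} {y} q with oneSided⁻ q
      ... | inj₁ (ja , _) with joins⁻ A x y ja
      ...   | S , a , x∈S , y∈S = S , A⇒E a , x∈S , y∈S
      oneSided⇒E {x} {y} q | inj₂ (_ , jb) with joins⁻ B x y jb
      ...   | S , b , x∈S , y∈S = S , B⇒E b , x∈S , y∈S

      oneSided⇒touchedˡ : ∀ {x y} → oneSided x y ≡ true → touched x ≡ true
      oneSided⇒touchedˡ {x} q with oneSided⇒E q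
      ... | S , e , x∈S , _ = E⇒touched x e x∈S

      oneSided⇒touchedʳ : ∀ {x y} → oneSided x y ≡ true → touched y ≡ true
      oneSided⇒touchedʳ {y = y} q with oneSided⇒E q
      ... | S , e , _ , y∈S = E⇒touched y e y∈S

      degIn≡1⇒unique : ∀ X x {S T} → degIn X x ≡ 1 →
                       X S ≡ true → x ∈ᵇ S ≡ true → X T ≡ true → x ∈ᵇ T ≡ true → S ≡ T
      degIn≡1⇒unique X x {S} {T} deg≡1 XS x∈S XT x∈T with S ≟ₛ T
      ... | yes S≡T = S≡T
      ... | no  S≢T = refute-≤ (subst (2 ≤_) deg≡1
                        (Subsets.2≤∑ (λ S → 𝟙 (X S ∧ x ∈ᵇ S)) S≢T
                          (≤-reflexive (sym (𝟙-true (∧-true⁺ XS x∈S))))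
                          (≤-reflexive (sym (𝟙-true (∧-true⁺ XT x∈T)))))) tt

      oneSided⁺ᴬ : ∀ {x y} → x ≢ y → joins A x y ≡ true → joins B x y ≡ false → oneSided x y ≡ true
      oneSided⁺ᴬ x≢y ja jb = oneSided⁺ x≢y (cong₂ _xor_ ja jb)

      oneSided⁺ᴮ : ∀ {x y} → x ≢ y → joins A x y ≡ false → joins B x y ≡ true → oneSided x y ≡ true
      oneSided⁺ᴮ x≢y ja jb = oneSided⁺ x≢y (cong₂ _xor_ ja jb)

      unique-E⇒oneSided : ∀ {x w} S → (∀ {T} → E T ≡ true → x ∈ᵇ T ≡ true → w ∈ᵇ T ≡ true → T ≡ S) →
                          E S ≡ true → x ∈ᵇ S ≡ true → w ∈ᵇ S ≡ true → x ≢ w → oneSided x w ≡ true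
      unique-E⇒oneSided {x} {w} S unique e x∈S w∈S x≢w with ∨-true⁻ {A S} e
      ... | inj₁ a = oneSided⁺ᴬ x≢w (joins⁺ A S a x∈S w∈S) noB
        where
        noB : joins B x w ≡ false
        noB with joins B x w in jb
        ... | false = refl
        ... | true with joins⁻ B x w jb
        ...   | T , b , x∈T , w∈T = A-B-disjoint a (subst (λ Z → B Z ≡ true) (unique (B⇒E b) x∈T w∈T) b)
      ... | inj₂ b = oneSided⁺ᴮ x≢w noA (joins⁺ B S b x∈S w∈S)
        where
        noA : joins A x w ≡ false
        noA with joins A x w in ja
        ... | false = refl
        ... | true with joins⁻ A x w ja
        ...   | T , a , x∈T , w∈T = A-B-disjoint (subst (λ Z → A Z ≡ true) (unique (A⇒E a) x∈T w∈T) a) b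

      oneSided-to-leaf : ∀ {x w S} → deg w ≡ 1 → E S ≡ true → x ∈ᵇ S ≡ true → w ∈ᵇ S ≡ true → x ≢ w →
                         oneSided x w ≡ true
      oneSided-to-leaf {w = w} {S} deg≡1 e x∈S w∈S =
        unique-E⇒oneSided S (λ eT _ w∈T → degIn≡1⇒unique E w deg≡1 eT w∈T e w∈S) e x∈S w∈S

      oneSided-from-leaf : ∀ {x w S} → deg x ≡ 1 → E S ≡ true → x ∈ᵇ S ≡ true → w ∈ᵇ S ≡ true → x ≢ w →
                           oneSided x w ≡ true
      oneSided-from-leaf {x} {S = S} deg≡1 e x∈S w∈S =
        unique-E⇒oneSided S (λ eT x∈T _ → degIn≡1⇒unique E x deg≡1 eT x∈T e x∈S) e x∈S w∈S

      leaf hub : Fin n → Bool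
      leaf x = isOne (deg x)
      hub  x = atLeastTwo (deg x)

      leaves : Subset n → ℕ
      leaves S = ∑ᵥ (λ w → 𝟙 (w ∈ᵇ S ∧ leaf w))

      leavesAround : Fin n → ℕ
      leavesAround x = ∑ₛ (λ S → 𝟙 (E S ∧ x ∈ᵇ S) * leaves S)

      donation : Fin n → ℕ
      donation x = ∑ₛ (λ S → 𝟙 (E S ∧ (x ∈ᵇ S ∧ hub x)) * gift (leaves S))

      donation≤9*leavesAround : ∀ x → donation x ≤ 9 * leavesAround x
      donation≤9*leavesAround x = ≤-trans (∑-mono (allSubsets n) bound) (≤-reflexive (∑-*ˡ (allSubsets n) 9 _))
        where
        bound : ∀ S → 𝟙 (E S ∧ (x ∈ᵇ S ∧ hub x)) * gift (leaves S) ≤ 9 * (𝟙 (E S ∧ x ∈ᵇ S) * leaves S)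
        bound S with E S | x ∈ᵇ S
        ... | true  | true  = ≤-trans (*-monoˡ-≤ _ (𝟙≤1 (hub x)))
                                (subst₂ _≤_ (sym (*-identityˡ (gift (leaves S)))) (cong (9 *_) (sym (*-identityˡ (leaves S))))
                                            (gift≤9* (leaves S)))
        ... | true  | false = z≤n
        ... | false | _     = z≤n

      donation≤*deg : ∀ x c → (∀ {S} → E S ≡ true → x ∈ᵇ S ≡ true → gift (leaves S) ≤ c) → donation x ≤ c * deg x
      donation≤*deg x c gift≤c = ≤-trans (∑-mono (allSubsets n) bound) (≤-reflexive (∑-*ˡ (allSubsets n) c _))
        where
        bound : ∀ S → 𝟙 (E S ∧ (x ∈ᵇ S ∧ hub x)) * gift (leaves S) ≤ c * 𝟙 (E S ∧ x ∈ᵇ S)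
        bound S with E S in e | x ∈ᵇ S in x∈S
        ... | true  | true  = ≤-trans (*-monoˡ-≤ _ (𝟙≤1 (hub x)))
                                (subst₂ _≤_ (sym (*-identityˡ (gift (leaves S)))) (sym (*-identityʳ c)) (gift≤c e x∈S))
        ... | true  | false = z≤n
        ... | false | _     = z≤n

      donation-of-non-hub : ∀ x → deg x ≤ 1 → donation x ≡ 0
      donation-of-non-hub x deg≤1 = trans (∑-cong (allSubsets n) none) (∑-zero (allSubsets n))
        where
        not-hub : ∀ d → d ≤ 1 → atLeastTwo d ≡ false
        not-hub 0 _ = refl
        not-hub 1 _ = refl
        not-hub (suc (suc _)) (s≤s ())
        none : ∀ S → 𝟙 (E S ∧ (x ∈ᵇ S ∧ hub x)) * gift (leaves S) ≡ 0
        none S rewrite not-hub (deg x) deg≤1 with E S | x ∈ᵇ S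
        ... | true  | true  = refl
        ... | true  | false = refl
        ... | false | _     = refl

      oneSidedDeg : Fin n → ℕ
      oneSidedDeg x = ∑ᵥ (𝟙 ∘ oneSided x)

      oneSided⇒1≤oneSidedDeg : ∀ {x z} → oneSided x z ≡ true → 1 ≤ oneSidedDeg x
      oneSided⇒1≤oneSidedDeg {x} q = Vertices.1≤∑𝟙 (oneSided x) q

      ∃-edge : ∀ X x → 1 ≤ degIn X x → ∃ λ S → X S ≡ true × x ∈ᵇ S ≡ true
      ∃-edge X x pos with ∑𝟙-positive⇒∃ (allSubsets n) (λ S → X S ∧ x ∈ᵇ S) pos
      ... | S , p = S , ∧-conicalˡ (X S) _ p , ∧-conicalʳ (X S) _ p

      leaf≢hub : ∀ {x w} → deg x ≡ 1 → 2 ≤ deg w → x ≢ w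
      leaf≢hub deg≡1 2≤deg refl = refute-≤ (subst (2 ≤_) deg≡1 2≤deg) tt

      leaf⇒3≤oneSidedDeg : ∀ {x T} → deg x ≡ 1 → E T ≡ true → x ∈ᵇ T ≡ true → 3 ≤ oneSidedDeg x
      leaf⇒3≤oneSidedDeg {x} {T} deg≡1 e x∈T =
        size-others {S = T} {x} _ (size-E e) x∈T (λ z z∈T z≢x → oneSided-from-leaf {S = T} deg≡1 e x∈T z∈T (z≢x ∘ sym))

      leavesAround≤oneSidedDeg : ∀ x → 2 ≤ deg x → leavesAround x ≤ oneSidedDeg x
      leavesAround≤oneSidedDeg x 2≤deg = begin
        leavesAround x
          ≡⟨ ∑-cong (allSubsets n) (λ S → sym (∑-*ˡ (allFin n) (𝟙 (E S ∧ x ∈ᵇ S)) _)) ⟩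
        ∑ₛ (λ S → ∑ᵥ (λ w → 𝟙 (E S ∧ x ∈ᵇ S) * 𝟙 (w ∈ᵇ S ∧ leaf w)))
          ≡⟨ ∑-comm (allSubsets n) (allFin n) _ ⟩
        ∑ᵥ leafEdgesVia
          ≤⟨ ∑-mono (allFin n) each ⟩
        oneSidedDeg x ∎
        where
        open ≤-Reasoning
        leafEdgesVia : Fin n → ℕ
        leafEdgesVia w = ∑ₛ (λ S → 𝟙 (E S ∧ x ∈ᵇ S) * 𝟙 (w ∈ᵇ S ∧ leaf w))
        at-most-one : ∀ w → leafEdgesVia w ≤ 1
        at-most-one w = begin
          leafEdgesVia w                        ≤⟨ ∑-mono (allSubsets n) bound ⟩
          ∑ₛ (λ S → 𝟙 (E S ∧ w ∈ᵇ S) * 𝟙 (leaf w)) ≡⟨ ∑-*ʳ (allSubsets n) _ (𝟙 (leaf w)) ⟩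
          deg w * 𝟙 (isOne (deg w))             ≤⟨ *𝟙isOne≤1 (deg w) ⟩
          1                                     ∎
          where
          bound : ∀ S → 𝟙 (E S ∧ x ∈ᵇ S) * 𝟙 (w ∈ᵇ S ∧ leaf w) ≤ 𝟙 (E S ∧ w ∈ᵇ S) * 𝟙 (leaf w)
          bound S with E S | x ∈ᵇ S | w ∈ᵇ S
          ... | true  | true  | true  = ≤-refl
          ... | true  | true  | false = z≤n
          ... | true  | false | _     = z≤n
          ... | false | _     | _     = z≤n
        via-oneSided : ∀ w → 1 ≤ leafEdgesVia w → oneSided x w ≡ true
        via-oneSided w pos with ∑-positive (allSubsets n) (λ S → 𝟙 (E S ∧ x ∈ᵇ S) * 𝟙 (w ∈ᵇ S ∧ leaf w)) pos
        ... | S , p with E S in e | x ∈ᵇ S in x∈S | w ∈ᵇ S in w∈S | leaf w in l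
        ...   | true | true | true | true =
          oneSided-to-leaf (isOne⇒≡1 l) e x∈S w∈S (leaf≢hub (isOne⇒≡1 l) 2≤deg ∘ sym)
        each : ∀ w → leafEdgesVia w ≤ 𝟙 (oneSided x w)
        each w with leafEdgesVia w in c
        ... | zero  = z≤n
        ... | suc _ rewrite via-oneSided w (subst (1 ≤_) (sym c) (s≤s z≤n)) = subst (_≤ 1) c (at-most-one w)

      module OneSide (X Y : Subset n → Bool)
        (X⇒E : ∀ {S} → X S ≡ true → E S ≡ true) (Y⇒E : ∀ {S} → Y S ≡ true → E S ≡ true)
        (X-Y-disjoint : ∀ {S} → X S ≡ true → Y S ≡ true → ∀ {Z : Set} → Z)
        (oneSided⁺X : ∀ {x y} → x ≢ y → joins X x y ≡ true → joins Y x y ≡ false → oneSided x y ≡ true)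
        (oneSided⁺Y : ∀ {x y} → x ≢ y → joins X x y ≡ false → joins Y x y ≡ true → oneSided x y ≡ true)
        where

        only-X⇒oneSided : ∀ {x T z} → degIn Y x ≡ 0 → X T ≡ true → x ∈ᵇ T ≡ true → z ∈ᵇ T ≡ true → z ≢ x →
                          oneSided x z ≡ true
        only-X⇒oneSided {x} {T} {z} noY XT x∈T z∈T z≢x = oneSided⁺X (z≢x ∘ sym) (joins⁺ X T XT x∈T z∈T) noJoinY
          where
          noJoinY : joins Y x z ≡ false
          noJoinY with joins Y x z in jy
          ... | false = refl
          ... | true with joins⁻ Y x z jy
          ...   | T′ , YT′ , x∈T′ , _ = refute-≤ (subst (1 ≤_) noY (1≤degIn Y x YT′ x∈T′)) tt

        ∃-oneSided-across : ∀ {x S T} → degIn X x ≡ 1 → X S ≡ true → x ∈ᵇ S ≡ true → Y T ≡ true → x ∈ᵇ T ≡ true →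
                            ∃ λ z → z ∈ᵇ T ≡ true × z ∈ᵇ S ≡ false × oneSided x z ≡ true
        ∃-oneSided-across {x} {S} {T} degX≡1 XS x∈S YT x∈T
          with ∃-∖ {S = S} {T} (≤-reflexive (trans (size-E (X⇒E XS)) (sym (size-E (Y⇒E YT)))))
                   (λ S≡T → X-Y-disjoint XS (subst (λ Z → Y Z ≡ true) (sym S≡T) YT))
        ... | z , z∈T , z∉S = z , z∈T , z∉S , oneSided⁺Y x≢z noJoinX (joins⁺ Y T YT x∈T z∈T)
          where
          x≢z : x ≢ z
          x≢z refl = true≢false x∈S z∉S
          noJoinX : joins X x z ≡ false
          noJoinX with joins X x z in jx
          ... | false = refl
          ... | true with joins⁻ X x z jx
          ...   | S′ , XS′ , x∈S′ , z∈S′ =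
            true≢false (subst (λ Z → z ∈ᵇ Z ≡ true) (degIn≡1⇒unique X x degX≡1 XS′ x∈S′ XS x∈S) z∈S′) z∉S

        two-X-edges⇒4≤oneSidedDeg : ∀ {x} → degIn Y x ≡ 0 → degIn X x ≡ 2 → 4 ≤ oneSidedDeg x
        two-X-edges⇒4≤oneSidedDeg {x} noY degX≡2
          with ∃-edge X x (subst (1 ≤_) (sym degX≡2) (s≤s z≤n))
        ... | S₁ , XS₁ , x∈S₁
          with Subsets.∃-second (λ S → 𝟙 (X S ∧ x ∈ᵇ S)) (λ S → 𝟙≤1 (X S ∧ x ∈ᵇ S)) (≤-reflexive (sym degX≡2)) S₁
        ...   | S₂ , S₂≢S₁ , p
          with ∃-∖ {S = S₁} {S₂} (≤-reflexive (trans (size-E (X⇒E XS₁)) (sym (size-E (X⇒E XS₂))))) (S₂≢S₁ ∘ sym)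
          where
          XS₂ = ∧-conicalˡ (X S₂) _ (𝟙-positive p)
        ...     | z , z∈S₂ , z∉S₁ =
          subst (_≤ oneSidedDeg x) (cong suc (suc-injective (trans (size-without {S = S₁} {x} x∈S₁) (size-E (X⇒E XS₁)))))
                (Vertices.∑-mono-< (λ w → 𝟙 (w ∈ᵇ S₁ ∧ not (does (w ≟ x)))) (𝟙 ∘ oneSided x) z partners extra)
          where
          XS₂ = ∧-conicalˡ (X S₂) _ (𝟙-positive p)
          x∈S₂ = ∧-conicalʳ (X S₂) _ (𝟙-positive p)
          partners : ∀ w → 𝟙 (w ∈ᵇ S₁ ∧ not (does (w ≟ x))) ≤ 𝟙 (oneSided x w)
          partners w with w ∈ᵇ S₁ in w∈S₁ | w ≟ x
          ... | true  | no w≢x rewrite only-X⇒oneSided noY XS₁ x∈S₁ w∈S₁ w≢x = ≤-refl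
          ... | true  | yes _  = z≤n
          ... | false | _      = z≤n
          z≢x : z ≢ x
          z≢x refl = true≢false x∈S₁ z∉S₁
          extra : 𝟙 (z ∈ᵇ S₁ ∧ not (does (z ≟ x))) < 𝟙 (oneSided x z)
          extra rewrite z∉S₁ | only-X⇒oneSided noY XS₂ x∈S₂ z∈S₂ z≢x = s≤s z≤n

        1+leaves≤oneSidedDeg : ∀ {x S T} → deg x ≡ 2 → degIn X x ≡ 1 →
                               X S ≡ true → x ∈ᵇ S ≡ true → Y T ≡ true → x ∈ᵇ T ≡ true →
                               suc (leaves S) ≤ oneSidedDeg x
        1+leaves≤oneSidedDeg {x} {S} {T} deg≡2 degX≡1 XS x∈S YT x∈T with ∃-oneSided-across degX≡1 XS x∈S YT x∈T
        ... | z , _ , z∉S , q = Vertices.∑-mono-< (λ w → 𝟙 (w ∈ᵇ S ∧ leaf w)) (𝟙 ∘ oneSided x) z partners extra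
          where
          partners : ∀ w → 𝟙 (w ∈ᵇ S ∧ leaf w) ≤ 𝟙 (oneSided x w)
          partners w with w ∈ᵇ S in w∈S | leaf w in l
          ... | true  | true
            rewrite oneSided-to-leaf (isOne⇒≡1 l) (X⇒E XS) x∈S w∈S (leaf≢hub (isOne⇒≡1 l) (≤-reflexive (sym deg≡2)) ∘ sym) = ≤-refl
          ... | true  | false = z≤n
          ... | false | _     = z≤n
          extra : 𝟙 (z ∈ᵇ S ∧ leaf z) < 𝟙 (oneSided x z)
          extra rewrite z∉S | q = s≤s z≤n

      module SideA = OneSide A B A⇒E B⇒E A-B-disjoint oneSided⁺ᴬ oneSided⁺ᴮ
      module SideB = OneSide B A B⇒E A⇒E (λ b a → A-B-disjoint a b)
                       (λ x≢y jb ja → oneSided⁺ᴮ x≢y ja jb) (λ x≢y jb ja → oneSided⁺ᴬ x≢y ja jb)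

      1≤oneSidedDeg : ∀ x → 1 ≤ deg x → deg x ≤ 3 → 1 ≤ oneSidedDeg x
      1≤oneSidedDeg x 1≤deg deg≤3 with degIn A x in da | degIn B x in db
      ... | 0 | _ with ∃-edge B x (subst (1 ≤_) (trans (deg≡degA+degB x) (cong (_+ degIn B x) da)) 1≤deg)
      ...   | T , bT , x∈T with ∃-other {S = T} {x} (size-E (B⇒E bT)) x∈T
      ...     | z , z∈T , z≢x = oneSided⇒1≤oneSidedDeg (SideB.only-X⇒oneSided da bT x∈T z∈T z≢x)
      1≤oneSidedDeg x _ _ | suc _ | 0 with ∃-edge A x (subst (1 ≤_) (sym da) (s≤s z≤n))
      ...   | S , aS , x∈S with ∃-other {S = S} {x} (size-E (A⇒E aS)) x∈S
      ...     | z , z∈S , z≢x = oneSided⇒1≤oneSidedDeg (SideA.only-X⇒oneSided db aS x∈S z∈S z≢x)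
      1≤oneSidedDeg x _ _ | 1 | suc _
        with ∃-edge A x (subst (1 ≤_) (sym da) (s≤s z≤n)) | ∃-edge B x (subst (1 ≤_) (sym db) (s≤s z≤n))
      ... | S , aS , x∈S | T , bT , x∈T with SideA.∃-oneSided-across da aS x∈S bT x∈T
      ...   | _ , _ , _ , q = oneSided⇒1≤oneSidedDeg q
      1≤oneSidedDeg x _ _ | suc (suc _) | 1
        with ∃-edge A x (subst (1 ≤_) (sym da) (s≤s z≤n)) | ∃-edge B x (subst (1 ≤_) (sym db) (s≤s z≤n))
      ... | S , aS , x∈S | T , bT , x∈T with SideB.∃-oneSided-across db bT x∈T aS x∈S
      ...   | _ , _ , _ , q = oneSided⇒1≤oneSidedDeg q
      1≤oneSidedDeg x _ deg≤3 | suc (suc a) | suc (suc b) =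
        refute-≤ (≤-trans 4≤ (subst (_≤ 3) (trans (deg≡degA+degB x) (cong₂ _+_ da db)) deg≤3)) tt
        where
        4≤ : 4 ≤ suc (suc a) + suc (suc b)
        4≤ = s≤s (s≤s (≤-trans (s≤s (s≤s z≤n)) (m≤n+m (suc (suc b)) a)))

      deg≡2⇒few-leaves : ∀ x → deg x ≡ 2 → oneSidedDeg x ≤ 2 →
                         oneSidedDeg x ≡ 2 × (∀ {S} → E S ≡ true → x ∈ᵇ S ≡ true → leaves S ≤ 1)
      deg≡2⇒few-leaves x deg≡2 q≤2 with degIn A x in da | degIn B x in db | trans (sym (deg≡degA+degB x)) deg≡2
      ... | 0 | 2 | _ = refute-≤ (≤-trans (SideB.two-X-edges⇒4≤oneSidedDeg da db) q≤2) tt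
      ... | 2 | 0 | _ = refute-≤ (≤-trans (SideA.two-X-edges⇒4≤oneSidedDeg db da) q≤2) tt
      ... | 1 | 1 | _
        with ∃-edge A x (subst (1 ≤_) (sym da) (s≤s z≤n)) | ∃-edge B x (subst (1 ≤_) (sym db) (s≤s z≤n))
      ...   | S , aS , x∈S | T , bT , x∈T
        with SideA.∃-oneSided-across da aS x∈S bT x∈T | SideB.∃-oneSided-across db bT x∈T aS x∈S
      ...     | z , _ , z∉S , qz | y , y∈S , _ , qy = q≡2 , leaves≤1
        where
        z≢y : z ≢ y
        z≢y refl = true≢false y∈S z∉S
        q≡2 : oneSidedDeg x ≡ 2
        q≡2 = ≤-antisym q≤2
          (Vertices.2≤∑ (𝟙 ∘ oneSided x) z≢y (≤-reflexive (sym (𝟙-true qz))) (≤-reflexive (sym (𝟙-true qy))))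
        leaves≤1 : ∀ {S′} → E S′ ≡ true → x ∈ᵇ S′ ≡ true → leaves S′ ≤ 1
        leaves≤1 {S′} e x∈S′ with ∨-true⁻ {A S′} e
        ... | inj₁ a rewrite degIn≡1⇒unique A x da a x∈S′ aS x∈S =
          ≤-pred (≤-trans (SideA.1+leaves≤oneSidedDeg deg≡2 da aS x∈S bT x∈T) q≤2)
        ... | inj₂ b rewrite degIn≡1⇒unique B x db b x∈S′ bT x∈T =
          ≤-pred (≤-trans (SideB.1+leaves≤oneSidedDeg deg≡2 db bT x∈T aS x∈S) q≤2)
      deg≡2⇒few-leaves x _ _ | 0 | 0 | ()
      deg≡2⇒few-leaves x _ _ | 0 | 1 | ()
      deg≡2⇒few-leaves x _ _ | 1 | 0 | ()
      deg≡2⇒few-leaves x _ _ | 0 | suc (suc (suc _)) | ()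
      deg≡2⇒few-leaves x _ _ | 1 | suc (suc _) | ()
      deg≡2⇒few-leaves x _ _ | 2 | suc _ | ()
      deg≡2⇒few-leaves x _ _ | suc (suc (suc _)) | _ | ()

      eE≡eA+eB : e E ≡ e A + e B
      eE≡eA+eB = trans (∑-cong (allSubsets n) split) (∑-+ (allSubsets n) (𝟙 ∘ A) (𝟙 ∘ B))
        where
        split : ∀ S → 𝟙 (E S) ≡ 𝟙 (A S) + 𝟙 (B S)
        split S with A S in a | B S in b
        ... | true  | true  = A-B-disjoint a b
        ... | true  | false = refl
        ... | false | true  = refl
        ... | false | false = refl

      ∑deg≡4*e : ∑ᵥ deg ≡ 4 * (e A + e B)
      ∑deg≡4*e = begin
        ∑ᵥ deg
          ≡⟨ ∑-comm (allFin n) (allSubsets n) _ ⟩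
        ∑ₛ (λ S → ∑ᵥ (λ x → 𝟙 (E S ∧ x ∈ᵇ S)))
          ≡⟨ ∑-cong (allSubsets n) (λ S → trans (∑-cong (allFin n) (λ x → 𝟙-∧ (E S) (x ∈ᵇ S))) (∑-*ˡ (allFin n) (𝟙 (E S)) _)) ⟩
        ∑ₛ (λ S → 𝟙 (E S) * size S)
          ≡⟨ ∑-cong (allSubsets n) four ⟩
        ∑ₛ (λ S → 4 * 𝟙 (E S))
          ≡⟨ ∑-*ˡ (allSubsets n) 4 _ ⟩
        4 * e E
          ≡⟨ cong (4 *_) eE≡eA+eB ⟩
        4 * (e A + e B) ∎
        where
        open ≡-Reasoning
        four : ∀ S → 𝟙 (E S) * size S ≡ 4 * 𝟙 (E S)
        four S with E S in e
        ... | true  = trans (+-identityʳ (size S)) (size-E e)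
        ... | false = refl

      hubs : Subset n → ℕ
      hubs S = ∑ᵥ (λ x → 𝟙 (x ∈ᵇ S ∧ hub x))

      leaves+hubs≡4 : ∀ {S} → E S ≡ true → leaves S + hubs S ≡ 4
      leaves+hubs≡4 {S} e = trans (sym (∑-+ (allFin n) _ _)) (trans (∑-cong (allFin n) split) (size-E e))
        where
        split : ∀ x → 𝟙 (x ∈ᵇ S ∧ leaf x) + 𝟙 (x ∈ᵇ S ∧ hub x) ≡ 𝟙 (x ∈ᵇ S)
        split x with x ∈ᵇ S in x∈S
        ... | false = refl
        ... | true with deg x | 1≤degIn E x e x∈S
        ...   | 1           | _ = refl
        ...   | suc (suc _) | _ = refl

      ∑leaves≡ : ∑ᵥ (𝟙 ∘ leaf) ≡ ∑ₛ (λ S → 𝟙 (E S) * leaves S)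
      ∑leaves≡ = begin
        ∑ᵥ (𝟙 ∘ leaf)
          ≡⟨ ∑-cong (allFin n) (λ x → sym (trans (∑-*ʳ (allSubsets n) _ (𝟙 (leaf x))) (*𝟙isOne≡𝟙isOne (deg x)))) ⟩
        ∑ᵥ (λ x → ∑ₛ (λ S → 𝟙 (E S ∧ x ∈ᵇ S) * 𝟙 (leaf x)))
          ≡⟨ ∑-comm (allFin n) (allSubsets n) _ ⟩
        ∑ₛ (λ S → ∑ᵥ (λ x → 𝟙 (E S ∧ x ∈ᵇ S) * 𝟙 (leaf x)))
          ≡⟨ ∑-cong (allSubsets n) (λ S → trans (∑-cong (allFin n) (regroup S)) (∑-*ˡ (allFin n) (𝟙 (E S)) _)) ⟩
        ∑ₛ (λ S → 𝟙 (E S) * leaves S) ∎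
        where
        open ≡-Reasoning
        regroup : ∀ S x → 𝟙 (E S ∧ x ∈ᵇ S) * 𝟙 (leaf x) ≡ 𝟙 (E S) * 𝟙 (x ∈ᵇ S ∧ leaf x)
        regroup S x with E S | x ∈ᵇ S
        ... | true  | true  = refl
        ... | true  | false = refl
        ... | false | _     = refl

      ∑donation≡ : ∑ᵥ donation ≡ ∑ₛ (λ S → 𝟙 (E S) * (hubs S * gift (leaves S)))
      ∑donation≡ = trans (∑-comm (allFin n) (allSubsets n) _) (∑-cong (allSubsets n) λ S →
        trans (∑-cong (allFin n) (λ x → trans (cong (_* gift (leaves S)) (𝟙-∧ (E S) (x ∈ᵇ S ∧ hub x))) (*-assoc (𝟙 (E S)) _ _)))
              (trans (∑-*ˡ (allFin n) (𝟙 (E S)) _) (cong (𝟙 (E S) *_) (∑-*ʳ (allFin n) _ (gift (leaves S))))))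

      leaves-paid : (∀ {S} → E S ≡ true → leaves S ≤ 3) → 9 * ∑ᵥ (𝟙 ∘ leaf) ≤ ∑ᵥ donation
      leaves-paid leaves≤3 = begin
        9 * ∑ᵥ (𝟙 ∘ leaf)                                    ≡⟨ cong (9 *_) ∑leaves≡ ⟩
        9 * ∑ₛ (λ S → 𝟙 (E S) * leaves S)                    ≡⟨ sym (∑-*ˡ (allSubsets n) 9 _) ⟩
        ∑ₛ (λ S → 9 * (𝟙 (E S) * leaves S))                  ≤⟨ ∑-mono (allSubsets n) per-edge ⟩
        ∑ₛ (λ S → 𝟙 (E S) * (hubs S * gift (leaves S)))      ≡⟨ sym ∑donation≡ ⟩
        ∑ᵥ donation                                          ∎
        where
        open ≤-Reasoning
        per-edge : ∀ S → 9 * (𝟙 (E S) * leaves S) ≤ 𝟙 (E S) * (hubs S * gift (leaves S))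
        per-edge S with E S in e
        ... | false = ≤-reflexive (*-zeroʳ 9)
        ... | true rewrite +-identityʳ (leaves S) | +-identityʳ (hubs S * gift (leaves S)) =
          leaf-budget (leaves S) (hubs S) (leaves+hubs≡4 e) (leaves≤3 e)

      non-leaf⇒leaves≤3 : ∀ {S w} → E S ≡ true → w ∈ᵇ S ≡ true → leaf w ≡ false → leaves S ≤ 3
      non-leaf⇒leaves≤3 {S} {w} e w∈S ¬leaf = ≤-pred (subst (leaves S <_) (size-E e)
        (Vertices.∑-mono-< (λ u → 𝟙 (u ∈ᵇ S ∧ leaf u)) (λ u → 𝟙 (u ∈ᵇ S)) w (λ u → 𝟙-∧≤ (u ∈ᵇ S) _) missing))
        where
        missing : 𝟙 (w ∈ᵇ S ∧ leaf w) < 𝟙 (w ∈ᵇ S)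
        missing rewrite w∈S | ¬leaf = s≤s z≤n

      module WithCover (cover-exists : ∀ x y → oneSided x y ≡ true → ∃ λ S → coversPair x y S ≡ true) where

        cover : Fin n → Fin n → Subset n
        cover x y = choose (coversPair x y)

        cover-spec : ∀ {x y} → oneSided x y ≡ true → coversPair x y (cover x y) ≡ true
        cover-spec {x} {y} q with cover-exists x y q
        ... | S , c = choose-spec (coversPair x y) (someSubset⁺ (coversPair x y) S c)

        cover-both : ∀ {x y} → oneSided x y ≡ true → both (cover x y) ≡ true
        cover-both q = ∧-conicalˡ _ _ (cover-spec q)

        x∈cover : ∀ {x y} → oneSided x y ≡ true → x ∈ᵇ cover x y ≡ true
        x∈cover {x} {y} q = ∧-conicalˡ _ _ (∧-conicalʳ (both (cover x y)) _ (cover-spec q))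

        assigned : Subset n → Fin n → Fin n → Bool
        assigned S x y = oneSided x y ∧ does (S ≟ₛ cover x y)

        load : Subset n → ℕ
        load S = ∑ᵥ λ x → ∑ᵥ λ y → 𝟙 (assigned S x y)

        used : Subset n → Bool
        used S = positive (load S)

        credit : Fin n → ℕ
        credit x = ∑ᵥ λ y → 𝟙 (oneSided x y) * price (load (cover x y))

        F : Hypergraph n
        F S = A S ∨ used S

        U : Subset n
        U = tabulate (λ x → touched x ∨ someSubset (λ S → used S ∧ x ∈ᵇ S))

        ∣V₀∣ : ℕ
        ∣V₀∣ = ∑ᵥ (𝟙 ∘ touched)

        inside : Subset n → Fin n → ℕ
        inside S x = 𝟙 (x ∈ᵇ S ∧ touched x)

        inner outer : Subset n → ℕ
        inner S = ∑ᵥ (inside S)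
        outer S = ∑ᵥ (λ x → 𝟙 (x ∈ᵇ S ∧ not (touched x)))

        assigned⇒oneSided : ∀ {S x y} → assigned S x y ≡ true → oneSided x y ≡ true
        assigned⇒oneSided a = ∧-conicalˡ _ _ a

        assigned⇒covers : ∀ {S x y} → assigned S x y ≡ true → coversPair x y S ≡ true
        assigned⇒covers {S} {x} {y} a with S ≟ₛ cover x y | ∧-conicalʳ (oneSided x y) _ a
        ... | yes refl | _ = cover-spec (∧-conicalˡ _ _ a)

        used⇒assigned : ∀ {S} → used S ≡ true → ∃ λ x → ∃ λ y → assigned S x y ≡ true
        used⇒assigned {S} u with ∑-positive (allFin n) (λ x → ∑ᵥ λ y → 𝟙 (assigned S x y)) (positive⁻ u)
        ... | x , pos with ∑𝟙-positive⇒∃ (allFin n) (assigned S x) pos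
        ...   | y , a = x , y , a

        used⇒both : ∀ {S} → used S ≡ true → both S ≡ true
        used⇒both {S} u with used⇒assigned {S} u
        ... | x , y , a = ∧-conicalˡ _ _ (assigned⇒covers {S} {x} {y} a)

        inner+outer≡size : ∀ S → inner S + outer S ≡ size S
        inner+outer≡size S = trans (sym (∑-+ (allFin n) _ _)) (∑-cong (allFin n) split)
          where
          split : ∀ x → inside S x + 𝟙 (x ∈ᵇ S ∧ not (touched x)) ≡ 𝟙 (x ∈ᵇ S)
          split x with x ∈ᵇ S | touched x
          ... | true  | true  = refl
          ... | true  | false = refl
          ... | false | _     = refl

        assigned+diagonal≤inside² : ∀ S x y → 𝟙 (assigned S x y) + 𝟙 (does (y ≟ x)) * inside S x ≤ inside S x * inside S y
        assigned+diagonal≤inside² S x y with y ≟ x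
        ... | yes refl with assigned S x x in a
        ...   | true  = contradiction refl (oneSided⇒≢ (assigned⇒oneSided {S} a))
        ...   | false = ≤-reflexive (trans (+-identityʳ (inside S x)) (sym (𝟙-idem (x ∈ᵇ S ∧ touched x))))
          where
          𝟙-idem : ∀ b → 𝟙 b * 𝟙 b ≡ 𝟙 b
          𝟙-idem true  = refl
          𝟙-idem false = refl
        assigned+diagonal≤inside² S x y | no _ with assigned S x y in a
        ... | false = z≤n
        ... | true  = ≤-reflexive (sym (cong₂ _*_ (𝟙-true (∧-true⁺ x∈S (oneSided⇒touchedˡ q)))
                                                  (𝟙-true (∧-true⁺ y∈S (oneSided⇒touchedʳ q)))))
          where
          q = assigned⇒oneSided {S} a
          x∧y = ∧-conicalʳ (both S) _ (assigned⇒covers {S} a)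
          x∈S = ∧-conicalˡ (x ∈ᵇ S) _ x∧y
          y∈S = ∧-conicalʳ (x ∈ᵇ S) _ x∧y

        load+inner≡ : ∀ S → load S + inner S ≡ ∑ᵥ (λ x → ∑ᵥ (λ y → 𝟙 (assigned S x y) + 𝟙 (does (y ≟ x)) * inside S x))
        load+inner≡ S = begin
          load S + inner S
            ≡⟨ cong (load S +_) (∑-cong (allFin n) (λ x → sym (Vertices.∑-pick (λ _ → inside S x) x))) ⟩
          load S + ∑ᵥ (λ x → ∑ᵥ (λ y → 𝟙 (does (y ≟ x)) * inside S x))
            ≡⟨ sym (∑-+ (allFin n) _ _) ⟩
          ∑ᵥ (λ x → ∑ᵥ (λ y → 𝟙 (assigned S x y)) + ∑ᵥ (λ y → 𝟙 (does (y ≟ x)) * inside S x))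
            ≡⟨ ∑-cong (allFin n) (λ x → sym (∑-+ (allFin n) _ _)) ⟩
          ∑ᵥ (λ x → ∑ᵥ (λ y → 𝟙 (assigned S x y) + 𝟙 (does (y ≟ x)) * inside S x)) ∎
          where open ≡-Reasoning

        ∑inside²≡inner² : ∀ S → ∑ᵥ (λ x → ∑ᵥ (λ y → inside S x * inside S y)) ≡ inner S * inner S
        ∑inside²≡inner² S = trans (∑-cong (allFin n) (λ x → ∑-*ˡ (allFin n) (inside S x) (inside S)))
                                  (∑-*ʳ (allFin n) (inside S) (inner S))

        load+inner≤inner² : ∀ S → load S + inner S ≤ inner S * inner S
        load+inner≤inner² S = subst₂ _≤_ (sym (load+inner≡ S)) (∑inside²≡inner² S)
          (∑-mono (allFin n) (λ x → ∑-mono (allFin n) (assigned+diagonal≤inside² S x)))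

        used-budget : ∀ S → 168 * (𝟙 (used S) * outer S) + load S * price (load S) ≤ 408 * 𝟙 (used S)
        used-budget S with used S in u
        ... | false rewrite ¬positive⇒≡0 u = z≤n
        ... | true  rewrite +-identityʳ (outer S) =
          used-edge-budget (inner S) (outer S) (load S) (trans (inner+outer≡size S) (size-both (used⇒both {S} u)))
                           (load+inner≤inner² S) (positive⁻ u)

        eF≡eA+eUsed : e F ≡ e A + e used
        eF≡eA+eUsed = trans (∑-cong (allSubsets n) split) (∑-+ (allSubsets n) (𝟙 ∘ A) (𝟙 ∘ used))
          where
          split : ∀ S → 𝟙 (F S) ≡ 𝟙 (A S) + 𝟙 (used S)
          split S with A S in a | used S in u
          ... | true  | true  = true≢false (∧-conicalʳ _ _ (used⇒both {S} u)) (A⇒¬g a)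
          ... | true  | false = refl
          ... | false | true  = refl
          ... | false | false = refl

        ∈ᵇU : ∀ x → x ∈ᵇ U ≡ touched x ∨ someSubset (λ S → used S ∧ x ∈ᵇ S)
        ∈ᵇU = lookup∘tabulate _

        size-U≤ : size U ≤ ∣V₀∣ + ∑ₛ (λ S → 𝟙 (used S) * outer S)
        size-U≤ = begin
          size U
            ≡⟨ ∑-cong (allFin n) (cong 𝟙 ∘ ∈ᵇU) ⟩
          ∑ᵥ (λ x → 𝟙 (touched x ∨ someSubset (λ S → used S ∧ x ∈ᵇ S)))
            ≤⟨ ∑-mono (allFin n) charge ⟩
          ∑ᵥ (λ x → 𝟙 (touched x) + ∑ₛ (λ S → 𝟙 (used S) * 𝟙 (x ∈ᵇ S ∧ not (touched x))))
            ≡⟨ ∑-+ (allFin n) _ _ ⟩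
          ∣V₀∣ + ∑ᵥ (λ x → ∑ₛ (λ S → 𝟙 (used S) * 𝟙 (x ∈ᵇ S ∧ not (touched x))))
            ≡⟨ cong (∣V₀∣ +_) (∑-comm (allFin n) (allSubsets n) _) ⟩
          ∣V₀∣ + ∑ₛ (λ S → ∑ᵥ (λ x → 𝟙 (used S) * 𝟙 (x ∈ᵇ S ∧ not (touched x))))
            ≡⟨ cong (∣V₀∣ +_) (∑-cong (allSubsets n) (λ S → ∑-*ˡ (allFin n) (𝟙 (used S)) _)) ⟩
          ∣V₀∣ + ∑ₛ (λ S → 𝟙 (used S) * outer S) ∎
          where
          open ≤-Reasoning
          charge : ∀ x → 𝟙 (touched x ∨ someSubset (λ S → used S ∧ x ∈ᵇ S)) ≤
                         𝟙 (touched x) + ∑ₛ (λ S → 𝟙 (used S) * 𝟙 (x ∈ᵇ S ∧ not (touched x)))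
          charge x with touched x
          ... | true  = s≤s z≤n
          ... | false with someSubset (λ S → used S ∧ x ∈ᵇ S) in some
          ...   | false = z≤n
          ...   | true with someSubset⁻ (λ S → used S ∧ x ∈ᵇ S) some
          ...     | S , p = subst (_≤ ∑ₛ (λ S → 𝟙 (used S) * 𝟙 (x ∈ᵇ S ∧ true)))
                              (cong₂ _*_ (𝟙-true (∧-conicalˡ (used S) _ p)) (𝟙-true (∧-true⁺ (∧-conicalʳ (used S) _ p) refl)))
                              (Subsets.term≤∑ (λ S → 𝟙 (used S) * 𝟙 (x ∈ᵇ S ∧ true)) S)

        ∑credit≡ : ∑ᵥ credit ≡ ∑ₛ (λ S → load S * price (load S))
        ∑credit≡ = begin
          ∑ᵥ credit
            ≡⟨ ∑-cong (allFin n) (λ x → ∑-cong (allFin n) (λ y → sym (by-edge x y))) ⟩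
          ∑ᵥ (λ x → ∑ᵥ (λ y → ∑ₛ (λ S → 𝟙 (assigned S x y) * price (load S))))
            ≡⟨ ∑-cong (allFin n) (λ x → ∑-comm (allFin n) (allSubsets n) _) ⟩
          ∑ᵥ (λ x → ∑ₛ (λ S → ∑ᵥ (λ y → 𝟙 (assigned S x y) * price (load S))))
            ≡⟨ ∑-comm (allFin n) (allSubsets n) _ ⟩
          ∑ₛ (λ S → ∑ᵥ (λ x → ∑ᵥ (λ y → 𝟙 (assigned S x y) * price (load S))))
            ≡⟨ ∑-cong (allSubsets n) factor ⟩
          ∑ₛ (λ S → load S * price (load S)) ∎
          where
          open ≡-Reasoning
          factor : ∀ S → ∑ᵥ (λ x → ∑ᵥ (λ y → 𝟙 (assigned S x y) * price (load S))) ≡ load S * price (load S)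
          factor S = trans (∑-cong (allFin n) (λ x → ∑-*ʳ (allFin n) _ (price (load S)))) (∑-*ʳ (allFin n) _ (price (load S)))
          by-edge : ∀ x y → ∑ₛ (λ S → 𝟙 (assigned S x y) * price (load S)) ≡ 𝟙 (oneSided x y) * price (load (cover x y))
          by-edge x y = begin
            ∑ₛ (λ S → 𝟙 (assigned S x y) * price (load S))
              ≡⟨ ∑-cong (allSubsets n) (λ S → trans (cong (_* price (load S)) (𝟙-∧ (oneSided x y) _)) (*-assoc (𝟙 (oneSided x y)) _ _)) ⟩
            ∑ₛ (λ S → 𝟙 (oneSided x y) * (𝟙 (does (S ≟ₛ cover x y)) * price (load S)))
              ≡⟨ ∑-*ˡ (allSubsets n) (𝟙 (oneSided x y)) _ ⟩
            𝟙 (oneSided x y) * ∑ₛ (λ S → 𝟙 (does (S ≟ₛ cover x y)) * price (load S))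
              ≡⟨ cong (𝟙 (oneSided x y) *_) (Subsets.∑-pick (price ∘ load) (cover x y)) ⟩
            𝟙 (oneSided x y) * price (load (cover x y)) ∎

        charged-edges : 168 * ∑ₛ (λ S → 𝟙 (used S) * outer S) + ∑ₛ (λ S → load S * price (load S)) ≤ 408 * e used
        charged-edges = begin
          168 * ∑ₛ (λ S → 𝟙 (used S) * outer S) + ∑ₛ (λ S → load S * price (load S))
            ≡⟨ cong (_+ ∑ₛ (λ S → load S * price (load S))) (sym (∑-*ˡ (allSubsets n) 168 _)) ⟩
          ∑ₛ (λ S → 168 * (𝟙 (used S) * outer S)) + ∑ₛ (λ S → load S * price (load S))
            ≡⟨ sym (∑-+ (allSubsets n) _ _) ⟩
          ∑ₛ (λ S → 168 * (𝟙 (used S) * outer S) + load S * price (load S))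
            ≤⟨ ∑-mono (allSubsets n) used-budget ⟩
          ∑ₛ (λ S → 408 * 𝟙 (used S))
            ≡⟨ ∑-*ˡ (allSubsets n) 408 _ ⟩
          408 * e used ∎
          where open ≤-Reasoning

        dense-if-charged : 168 * ∣V₀∣ ≤ 408 * e A + ∑ᵥ credit → 7 * size U ≤ 17 * e F
        dense-if-charged charged = *-cancelˡ-≤ 24 (begin
          24 * (7 * size U)
            ≡⟨ sym (*-assoc 24 7 (size U)) ⟩
          168 * size U
            ≤⟨ *-monoʳ-≤ 168 size-U≤ ⟩
          168 * (∣V₀∣ + P)
            ≡⟨ *-distribˡ-+ 168 ∣V₀∣ P ⟩
          168 * ∣V₀∣ + 168 * P
            ≤⟨ +-monoˡ-≤ (168 * P) charged ⟩
          408 * e A + ∑ᵥ credit + 168 * P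
            ≡⟨ +-assoc (408 * e A) _ _ ⟩
          408 * e A + (∑ᵥ credit + 168 * P)
            ≡⟨ cong (408 * e A +_) (trans (+-comm _ (168 * P)) (cong (168 * P +_) ∑credit≡)) ⟩
          408 * e A + (168 * P + L)
            ≤⟨ +-monoʳ-≤ (408 * e A) charged-edges ⟩
          408 * e A + 408 * e used
            ≡⟨ sym (*-distribˡ-+ 408 (e A) (e used)) ⟩
          408 * (e A + e used)
            ≡⟨ cong (408 *_) (sym eF≡eA+eUsed) ⟩
          408 * e F
            ≡⟨ *-assoc 24 17 (e F) ⟩
          24 * (17 * e F) ∎)
          where
          open ≤-Reasoning
          P L : ℕ
          P = ∑ₛ (λ S → 𝟙 (used S) * outer S)
          L = ∑ₛ (λ S → load S * price (load S))

        dense-subhypergraph : ∀ {S₀} → A S₀ ≡ true → 168 * ∣V₀∣ ≤ 408 * e A + ∑ᵥ credit → DenseSubhypergraph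
        dense-subhypergraph {S₀} a charged = K , subst (λ u → 7 * u ≤ 17 * e F) (sym (∣∣≡size U)) (dense-if-charged charged)
          where
          x₀∈S₀ : ∃ λ x → x ∈ᵇ S₀ ≡ true
          x₀∈S₀ = ∃-∈ᵇ {S = S₀} (≤-trans (s≤s z≤n) (≤-reflexive (sym (size-h (A⇒h a)))))
          A⊆U : ∀ {S x} → A S ≡ true → x ∈ᵇ S ≡ true → x ∈ᵇ U ≡ true
          A⊆U {S} {x} a x∈S = trans (∈ᵇU x) (cong (_∨ someSubset (λ S → used S ∧ x ∈ᵇ S)) (E⇒touched {S} x (A⇒E a) x∈S))
          U-nonempty : NonZero ∣ U ∣
          U-nonempty = >-nonZero (subst (1 ≤_) (sym (∣∣≡size U))
            (Vertices.1≤∑𝟙 (_∈ᵇ U) (A⊆U {S₀} a (proj₂ x₀∈S₀))))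
          F⊆h : ∀ S → F S ≡ true → h S ≡ true
          F⊆h S f with ∨-true⁻ {A S} f
          ... | inj₁ a = A⇒h a
          ... | inj₂ u = ∧-conicalˡ _ _ (used⇒both {S} u)
          F-in-U : ∀ S → F S ≡ true → S ⊆ U
          F-in-U S f {x} x∈S with ∨-true⁻ {A S} f
          ... | inj₁ a = ∈ᵇ⇒∈ (A⊆U {S} a (∈⇒∈ᵇ x∈S))
          ... | inj₂ u = ∈ᵇ⇒∈ (trans (∈ᵇU x) (trans (cong (touched x ∨_) in-used) (∨-zeroʳ _)))
            where
            in-used = someSubset⁺ (λ S → used S ∧ x ∈ᵇ S) S (∧-true⁺ u (∈⇒∈ᵇ x∈S))
          K : SubHypergraph h
          K = record { U = U ; F = F ; U-nonempty = U-nonempty ; F⊆H = F⊆h ; F-in-U = F-in-U }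

        34*oneSidedDeg≤credit : ∀ x → 34 * oneSidedDeg x ≤ credit x
        34*oneSidedDeg≤credit x = ≤-trans (≤-reflexive (sym (∑-*ˡ (allFin n) 34 _))) (∑-mono (allFin n) each)
          where
          each : ∀ y → 34 * 𝟙 (oneSided x y) ≤ 𝟙 (oneSided x y) * price (load (cover x y))
          each y with oneSided x y
          ... | true  = ≤-trans (34≤price _) (≤-reflexive (sym (+-identityʳ _)))
          ... | false = ≤-reflexive (*-zeroʳ 34)

        credit≡36*oneSidedDeg : ∀ x → (∀ {y} → oneSided x y ≡ true → full (load (cover x y)) ≡ false) →
                                credit x ≡ 36 * oneSidedDeg x
        credit≡36*oneSidedDeg x not-full = trans (∑-cong (allFin n) each) (∑-*ˡ (allFin n) 36 _)
          where
          each : ∀ y → 𝟙 (oneSided x y) * price (load (cover x y)) ≡ 36 * 𝟙 (oneSided x y)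
          each y with oneSided x y in q
          ... | true rewrite not-full q = refl
          ... | false = refl

        inner≡size⇒touched : ∀ {S x} → inner S ≡ size S → x ∈ᵇ S ≡ true → touched x ≡ true
        inner≡size⇒touched {S} {x} inner≡size x∈S with touched x in t
        ... | true  = refl
        ... | false = ⊥-elim (<-irrefl inner≡size
                        (Vertices.∑-mono-< (inside S) (λ u → 𝟙 (u ∈ᵇ S)) x (λ u → 𝟙-∧≤ (u ∈ᵇ S) _) missing))
          where
          missing : inside S x < 𝟙 (x ∈ᵇ S)
          missing rewrite x∈S | t = s≤s z≤n

        full⇒inner≡4 : ∀ {S} → both S ≡ true → full (load S) ≡ true → inner S ≡ 4
        full⇒inner≡4 {S} c f with inner S | ≤-trans (m≤m+n (inner S) (outer S)) (≤-reflexive (trans (inner+outer≡size S) (size-both c)))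
                                | subst (λ l → l + inner S ≤ inner S * inner S) (full⇒≡12 f) (load+inner≤inner² S)
        ... | 0 | _ | bound = refute-≤ bound tt
        ... | 1 | _ | bound = refute-≤ bound tt
        ... | 2 | _ | bound = refute-≤ bound tt
        ... | 3 | _ | bound = refute-≤ bound tt
        ... | 4 | _ | _     = refl
        ... | suc (suc (suc (suc (suc _)))) | s≤s (s≤s (s≤s (s≤s ()))) | _

        unassigned⇒load+inner<inner² : ∀ {S x z} → inside S x ≡ 1 → inside S z ≡ 1 → z ≢ x → assigned S x z ≡ false →
                                        suc (load S + inner S) ≤ inner S * inner S
        unassigned⇒load+inner<inner² {S} {x} {z} ix iz z≢x a =
          subst₂ _≤_ (cong suc (sym (load+inner≡ S))) (∑inside²≡inner² S)
            (Vertices.∑-mono-< _ _ x (λ u → ∑-mono (allFin n) (assigned+diagonal≤inside² S u))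
              (Vertices.∑-mono-< _ _ z (assigned+diagonal≤inside² S x) missing))
          where
          missing : 𝟙 (assigned S x z) + 𝟙 (does (z ≟ x)) * inside S x < inside S x * inside S z
          missing rewrite a | dec-false (z ≟ x) z≢x | ix | iz = s≤s z≤n

        full⇒assigned : ∀ {S x z} → both S ≡ true → full (load S) ≡ true → x ∈ᵇ S ≡ true → z ∈ᵇ S ≡ true → z ≢ x →
                        assigned S x z ≡ true
        full⇒assigned {S} {x} {z} c f x∈S z∈S z≢x with assigned S x z in a
        ... | true  = refl
        ... | false = refute-≤ (subst₂ (λ l i → suc (l + i) ≤ i * i) (full⇒≡12 f) inner≡4
                        (unassigned⇒load+inner<inner² {S} (is-inside x∈S) (is-inside z∈S) z≢x a)) tt
          where
          inner≡4 = full⇒inner≡4 {S} c f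
          is-inside : ∀ {u} → u ∈ᵇ S ≡ true → inside S u ≡ 1
          is-inside u∈S = 𝟙-true (∧-true⁺ u∈S (inner≡size⇒touched {S} (trans inner≡4 (sym (size-both c))) u∈S))

        full-cover⇒3≤oneSidedDeg : ∀ {x y} → oneSided x y ≡ true → full (load (cover x y)) ≡ true → 3 ≤ oneSidedDeg x
        full-cover⇒3≤oneSidedDeg {x} {y} q f =
          size-others {S = cover x y} {x} (oneSided x) (size-both (cover-both q)) (x∈cover q)
            (λ z z∈S z≢x → assigned⇒oneSided {cover x y} (full⇒assigned {cover x y} (cover-both q) f (x∈cover q) z∈S z≢x))

        few-oneSided⇒not-full : ∀ x → oneSidedDeg x ≤ 2 → ∀ {y} → oneSided x y ≡ true → full (load (cover x y)) ≡ false
        few-oneSided⇒not-full x q≤2 {y} q with full (load (cover x y)) in f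
        ... | false = refl
        ... | true  = refute-≤ (≤-trans (full-cover⇒3≤oneSidedDeg q f) q≤2) tt

        leaf⇒not-full : ∀ x → deg x ≡ 1 → ∀ {y} → oneSided x y ≡ true → full (load (cover x y)) ≡ false
        leaf⇒not-full x deg≡1 {y} q with full (load (cover x y)) in f
        ... | false = refl
        ... | true with ∃-edge E x (≤-reflexive (sym deg≡1))
        ...   | T , eT , x∈T = E-both-disjoint eT (subst (λ Z → both Z ≡ true) S≡T c)
          where
          S = cover x y
          c = cover-both q
          S⊆T : ∀ z → z ∈ᵇ S ≡ true → z ∈ᵇ T ≡ true
          S⊆T z z∈S with z ≟ x
          ... | yes refl = x∈T
          ... | no z≢x with oneSided⇒E (assigned⇒oneSided {S} (full⇒assigned {S} c f (x∈cover q) z∈S z≢x))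
          ...   | T′ , eT′ , x∈T′ , z∈T′ =
            subst (λ Z → z ∈ᵇ Z ≡ true) (degIn≡1⇒unique E x deg≡1 eT′ x∈T′ eT x∈T) z∈T′
          S≡T : S ≡ T
          S≡T = ⊆∧size≥⇒≡ S⊆T (≤-reflexive (trans (size-E eT) (sym (size-both c))))

        vertex-discharge : ∀ x → 168 * 𝟙 (touched x) + donation x ≤ 51 * deg x + credit x + 9 * 𝟙 (leaf x)
        vertex-discharge x = by-degree (deg x) refl
          where
          hub-case : ∀ {d} → deg x ≡ d → 2 ≤ d → 168 ≤ 51 * d + 25 * oneSidedDeg x → 168 + donation x ≤ 51 * d + credit x + 0
          hub-case refl 2≤deg base = hub-budget {deg x} {donation x} {credit x} {oneSidedDeg x} base
            (≤-trans (donation≤9*leavesAround x) (*-monoʳ-≤ 9 (leavesAround≤oneSidedDeg x 2≤deg)))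
            (34*oneSidedDeg≤credit x)
          by-degree : ∀ d → deg x ≡ d → 168 * 𝟙 (positive d) + donation x ≤ 51 * d + credit x + 9 * 𝟙 (isOne d)
          by-degree 0 deg≡0 rewrite donation-of-non-hub x (≤-trans (≤-reflexive deg≡0) z≤n) = z≤n
          by-degree 1 deg≡1 with ∃-edge E x (≤-reflexive (sym deg≡1))
          ... | T , eT , x∈T rewrite donation-of-non-hub x (≤-reflexive deg≡1) | credit≡36*oneSidedDeg x (leaf⇒not-full x deg≡1) =
            +-monoˡ-≤ 9 (+-monoʳ-≤ 51 (*-monoʳ-≤ 36 (leaf⇒3≤oneSidedDeg deg≡1 eT x∈T)))
          by-degree 2 deg≡2 with oneSidedDeg x ≤? 2
          ... | yes q≤2 with deg≡2⇒few-leaves x deg≡2 q≤2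
          ...   | q≡2 , leaves≤1 rewrite credit≡36*oneSidedDeg x (few-oneSided⇒not-full x q≤2) | q≡2 =
            +-monoʳ-≤ 168 (≤-trans (donation≤*deg x 3 (λ e x∈S → gift≤3 _ (leaves≤1 e x∈S))) (≤-reflexive (cong (3 *_) deg≡2)))
          by-degree 2 deg≡2 | no q≰2 =
            hub-case deg≡2 ≤-refl (≤-trans (m≤m+n 168 9) (+-monoʳ-≤ 102 (*-monoʳ-≤ 25 (≰⇒> q≰2))))
          by-degree 3 deg≡3 =
            hub-case deg≡3 (s≤s (s≤s z≤n)) (≤-trans (m≤m+n 168 10) (+-monoʳ-≤ 153 (*-monoʳ-≤ 25
              (1≤oneSidedDeg x (≤-trans (s≤s z≤n) (≤-reflexive (sym deg≡3))) (≤-reflexive deg≡3)))))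
          by-degree d@(suc (suc (suc (suc k)))) deg≡d =
            hub-case deg≡d (s≤s (s≤s z≤n))
              (≤-trans (≤-trans (m≤m+n 168 36) (*-monoʳ-≤ 51 (s≤s (s≤s (s≤s (s≤s (z≤n {k}))))))) (m≤m+n _ _))

        charged-if-few-leaves : (∀ {S} → E S ≡ true → leaves S ≤ 3) → e B ≤ e A → 168 * ∣V₀∣ ≤ 408 * e A + ∑ᵥ credit
        charged-if-few-leaves leaves≤3 eB≤eA = +-cancelʳ-≤ (∑ᵥ donation) _ _ (begin
          168 * ∣V₀∣ + ∑ᵥ donation
            ≡⟨ cong (_+ ∑ᵥ donation) (sym (∑-*ˡ (allFin n) 168 _)) ⟩
          ∑ᵥ (λ x → 168 * 𝟙 (touched x)) + ∑ᵥ donation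
            ≡⟨ sym (∑-+ (allFin n) _ _) ⟩
          ∑ᵥ (λ x → 168 * 𝟙 (touched x) + donation x)
            ≤⟨ ∑-mono (allFin n) vertex-discharge ⟩
          ∑ᵥ (λ x → 51 * deg x + credit x + 9 * 𝟙 (leaf x))
            ≡⟨ trans (∑-+ (allFin n) _ _) (cong₂ _+_ (∑-+ (allFin n) _ _) (∑-*ˡ (allFin n) 9 _)) ⟩
          ∑ᵥ (λ x → 51 * deg x) + ∑ᵥ credit + 9 * ∑ᵥ (𝟙 ∘ leaf)
            ≤⟨ +-monoʳ-≤ (∑ᵥ (λ x → 51 * deg x) + ∑ᵥ credit) (leaves-paid leaves≤3) ⟩
          ∑ᵥ (λ x → 51 * deg x) + ∑ᵥ credit + ∑ᵥ donation
            ≡⟨ cong (λ t → t + ∑ᵥ credit + ∑ᵥ donation) (trans (∑-*ˡ (allFin n) 51 deg) (cong (51 *_) ∑deg≡4*e)) ⟩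
          51 * (4 * (e A + e B)) + ∑ᵥ credit + ∑ᵥ donation
            ≤⟨ +-monoˡ-≤ (∑ᵥ donation) (+-monoˡ-≤ (∑ᵥ credit) edges) ⟩
          408 * e A + ∑ᵥ credit + ∑ᵥ donation ∎)
          where
          open ≤-Reasoning
          edges : 51 * (4 * (e A + e B)) ≤ 408 * e A
          edges = begin
            51 * (4 * (e A + e B))  ≡⟨ sym (*-assoc 51 4 (e A + e B)) ⟩
            204 * (e A + e B)       ≤⟨ *-monoʳ-≤ 204 (+-monoʳ-≤ (e A) eB≤eA) ⟩
            204 * (e A + e A)       ≡⟨ *-distribˡ-+ 204 (e A) (e A) ⟩
            204 * e A + 204 * e A   ≡⟨ sym (*-distribʳ-+ (e A) 204 204) ⟩
            408 * e A               ∎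

    eh≡eOnlyH+eBoth : e h ≡ e onlyH + e both
    eh≡eOnlyH+eBoth = trans (∑-cong (allSubsets n) split) (∑-+ (allSubsets n) (𝟙 ∘ onlyH) (𝟙 ∘ both))
      where
      split : ∀ S → 𝟙 (h S) ≡ 𝟙 (onlyH S) + 𝟙 (both S)
      split S with h S | g S
      ... | true  | true  = refl
      ... | true  | false = refl
      ... | false | _     = refl

    eg≡eOnlyG+eBoth : e g ≡ e onlyG + e both
    eg≡eOnlyG+eBoth = trans (∑-cong (allSubsets n) split) (∑-+ (allSubsets n) (𝟙 ∘ onlyG) (𝟙 ∘ both))
      where
      split : ∀ S → 𝟙 (g S) ≡ 𝟙 (onlyG S) + 𝟙 (both S)
      split S with h S | g S
      ... | true  | true  = refl
      ... | false | true  = refl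
      ... | true  | false = refl
      ... | false | false = refl

    touchesOnlyH : Subset n → Bool
    touchesOnlyH T = someVertex (λ x → x ∈ᵇ T ∧ someSubset (λ S → onlyH S ∧ x ∈ᵇ S))

    nearOnlyG : Subset n → Bool
    nearOnlyG T = onlyG T ∧ touchesOnlyH T

    module Near = Discharging onlyH nearOnlyG (λ a → a) (∧-conicalˡ _ _)

    nearOnlyG⁺ : ∀ {x S T} → onlyH S ≡ true → x ∈ᵇ S ≡ true → onlyG T ≡ true → x ∈ᵇ T ≡ true → nearOnlyG T ≡ true
    nearOnlyG⁺ {x} {S} {T} a x∈S b x∈T = ∧-true⁺ b
      (someVertex⁺ (λ x → x ∈ᵇ T ∧ someSubset (λ S → onlyH S ∧ x ∈ᵇ S)) x
        (∧-true⁺ x∈T (someSubset⁺ (λ S → onlyH S ∧ x ∈ᵇ S) S (∧-true⁺ a x∈S))))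

    2≤Near-deg : ∀ {x S T} → onlyH S ≡ true → x ∈ᵇ S ≡ true → nearOnlyG T ≡ true → x ∈ᵇ T ≡ true → 2 ≤ Near.deg x
    2≤Near-deg {x} {S} {T} a x∈S b x∈T = Subsets.2≤∑ (λ S → 𝟙 (Near.E S ∧ x ∈ᵇ S)) S≢T
      (≤-reflexive (sym (𝟙-true (∧-true⁺ (Near.A⇒E a) x∈S))))
      (≤-reflexive (sym (𝟙-true (∧-true⁺ (Near.B⇒E b) x∈T))))
      where
      S≢T : S ≢ T
      S≢T refl = Near.A-B-disjoint a b

    eOnlyG≤eOnlyH : e g ≤ e h → e onlyG ≤ e onlyH
    eOnlyG≤eOnlyH eg≤eh = +-cancelʳ-≤ (e both) _ _ (subst₂ _≤_ eg≡eOnlyG+eBoth eh≡eOnlyH+eBoth eg≤eh)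

    ∃-onlyH : (∃ λ S → h S ≢ g S) → e g ≤ e h → ∃ λ S → onlyH S ≡ true
    ∃-onlyH (S , hS≢gS) eg≤eh with e onlyH in count
    ... | suc _ = ∑𝟙-positive⇒∃ (allSubsets n) onlyH (subst (1 ≤_) (sym count) (s≤s z≤n))
    ∃-onlyH (S , hS≢gS) eg≤eh | zero with h S in hS | g S in gS
    ... | true  | true  = contradiction refl hS≢gS
    ... | false | false = contradiction refl hS≢gS
    ... | true  | false = refute-≤ (subst (1 ≤_) count (1≤e onlyH (∧-true⁺ hS (cong not gS)))) tt
    ... | false | true  = refute-≤ (subst (1 ≤_) count (≤-trans (1≤e onlyG (∧-true⁺ gS (cong not hS))) (eOnlyG≤eOnlyH eg≤eh))) tt

    module WithSameProj (same-proj : SameProj h g) where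

      g-covers-onlyH-pair : ∀ {x y S} → x ≢ y → onlyH S ≡ true → x ∈ᵇ S ≡ true → y ∈ᵇ S ≡ true →
                            (∃ λ T → both T ≡ true × x ∈ᵇ T ≡ true × y ∈ᵇ T ≡ true) ⊎
                            (∃ λ T → nearOnlyG T ≡ true × x ∈ᵇ T ≡ true × y ∈ᵇ T ≡ true)
      g-covers-onlyH-pair {x} {y} {S} x≢y a x∈S y∈S
        with Equivalence.to (same-proj x y) (x≢y , S , ∧-conicalˡ _ _ a , ∈ᵇ⇒∈ x∈S , ∈ᵇ⇒∈ y∈S)
      ... | _ , T , gT , x∈T , y∈T with h T in hT
      ...   | true  = inj₁ (T , ∧-true⁺ hT gT , ∈⇒∈ᵇ x∈T , ∈⇒∈ᵇ y∈T)
      ...   | false = inj₂ (T , nearOnlyG⁺ a x∈S (∧-true⁺ gT (cong not hT)) (∈⇒∈ᵇ x∈T) , ∈⇒∈ᵇ x∈T , ∈⇒∈ᵇ y∈T)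

      h-covers-onlyG-pair : ∀ {x y T} → x ≢ y → onlyG T ≡ true → x ∈ᵇ T ≡ true → y ∈ᵇ T ≡ true →
                            (∃ λ S → both S ≡ true × x ∈ᵇ S ≡ true × y ∈ᵇ S ≡ true) ⊎
                            (∃ λ S → onlyH S ≡ true × x ∈ᵇ S ≡ true × y ∈ᵇ S ≡ true)
      h-covers-onlyG-pair {x} {y} {T} x≢y b x∈T y∈T
        with Equivalence.from (same-proj x y) (x≢y , T , ∧-conicalˡ _ _ b , ∈ᵇ⇒∈ x∈T , ∈ᵇ⇒∈ y∈T)
      ... | _ , S , hS , x∈S , y∈S with g S in gS
      ...   | true  = inj₁ (S , ∧-true⁺ hS gS , ∈⇒∈ᵇ x∈S , ∈⇒∈ᵇ y∈S)
      ...   | false = inj₂ (S , ∧-true⁺ hS (cong not gS) , ∈⇒∈ᵇ x∈S , ∈⇒∈ᵇ y∈S)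

      Near-cover : ∀ x y → Near.oneSided x y ≡ true → ∃ λ S → Near.coversPair x y S ≡ true
      Near-cover x y q with Near.oneSided⁻ q
      ... | inj₁ (ja , jb) with Near.joins⁻ onlyH x y ja
      ...   | S , a , x∈S , y∈S with g-covers-onlyH-pair (Near.oneSided⇒≢ q) a x∈S y∈S
      ...     | inj₁ (T , c , x∈T , y∈T) = T , ∧-true⁺ c (∧-true⁺ x∈T y∈T)
      ...     | inj₂ (T , b , x∈T , y∈T) = true≢false (Near.joins⁺ nearOnlyG T b x∈T y∈T) jb
      Near-cover x y q | inj₂ (ja , jb) with Near.joins⁻ nearOnlyG x y jb
      ...   | T , b , x∈T , y∈T with h-covers-onlyG-pair (Near.oneSided⇒≢ q) (∧-conicalˡ _ _ b) x∈T y∈T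
      ...     | inj₁ (S , c , x∈S , y∈S) = S , ∧-true⁺ c (∧-true⁺ x∈S y∈S)
      ...     | inj₂ (S , a , x∈S , y∈S) = true≢false (Near.joins⁺ onlyH S a x∈S y∈S) ja

      module NearCover = Near.WithCover Near-cover

      dense-if-no-isolated-edge : ∀ {S₀} → onlyH S₀ ≡ true → (∀ {S} → onlyH S ≡ true → Near.leaves S ≤ 3) →
                                 e g ≤ e h → DenseSubhypergraph
      dense-if-no-isolated-edge a₀ hub-in-every eg≤eh =
        NearCover.dense-subhypergraph a₀ (NearCover.charged-if-few-leaves leaves≤3 eNear≤eOnlyH)
        where
        leaves≤3 : ∀ {S} → Near.E S ≡ true → Near.leaves S ≤ 3
        leaves≤3 {S} e with ∨-true⁻ {onlyH S} e
        ... | inj₁ a = hub-in-every a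
        ... | inj₂ b with someVertex⁻ _ (∧-conicalʳ (onlyG S) _ b)
        ...   | x , p with someSubset⁻ (λ S′ → onlyH S′ ∧ x ∈ᵇ S′) (∧-conicalʳ (x ∈ᵇ S) _ p)
        ...     | S′ , p′ = Near.non-leaf⇒leaves≤3 e x∈S
                              (2≤⇒¬isOne (2≤Near-deg (∧-conicalˡ (onlyH S′) _ p′) (∧-conicalʳ (onlyH S′) _ p′) b x∈S))
          where
          x∈S = ∧-conicalˡ (x ∈ᵇ S) _ p
        eNear≤eOnlyH : e nearOnlyG ≤ e onlyH
        eNear≤eOnlyH = ≤-trans (∑-mono (allSubsets n) (λ S → 𝟙-∧≤ (onlyG S) (touchesOnlyH S))) (eOnlyG≤eOnlyH eg≤eh)

      module Isolated {S₁} (a₁ : onlyH S₁ ≡ true) (all-leaves : ∀ {w} → w ∈ᵇ S₁ ≡ true → Near.leaf w ≡ true) where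

        Single : Subset n → Bool
        Single S = does (S ≟ₛ S₁)

        Single⇒≡ : ∀ {S} → Single S ≡ true → S ≡ S₁
        Single⇒≡ {S} s with S ≟ₛ S₁
        ... | yes S≡S₁ = S≡S₁
        ... | no  _    = true≢false s refl

        Single-S₁ : Single S₁ ≡ true
        Single-S₁ = dec-true (S₁ ≟ₛ S₁) refl

        module One = Discharging Single (λ _ → false) (λ s → subst (λ Z → onlyH Z ≡ true) (sym (Single⇒≡ s)) a₁) (λ ())

        One-deg : ∀ x → One.deg x ≡ 𝟙 (x ∈ᵇ S₁)
        One-deg x = trans (∑-cong (allSubsets n) regroup) (Subsets.∑-pick (λ S → 𝟙 (x ∈ᵇ S)) S₁)
          where
          regroup : ∀ S → 𝟙 ((Single S ∨ false) ∧ x ∈ᵇ S) ≡ 𝟙 (Single S) * 𝟙 (x ∈ᵇ S)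
          regroup S with Single S
          ... | true  = sym (+-identityʳ _)
          ... | false = refl

        One-cover : ∀ x y → One.oneSided x y ≡ true → ∃ λ S → One.coversPair x y S ≡ true
        One-cover x y q with One.oneSided⁻ q
        ... | inj₂ (_ , jb) with One.joins⁻ (λ _ → false) x y jb
        ...   | _ , () , _
        One-cover x y q | inj₁ (ja , _) with One.joins⁻ Single x y ja
        ... | S , s , x∈S , y∈S with g-covers-onlyH-pair (One.oneSided⇒≢ q) a₁ (in-S₁ x∈S) (in-S₁ y∈S)
          where
          in-S₁ : ∀ {u} → u ∈ᵇ S ≡ true → u ∈ᵇ S₁ ≡ true
          in-S₁ {u} = subst (λ Z → u ∈ᵇ Z ≡ true) (Single⇒≡ {S} s)
        ...   | inj₁ (T , c , x∈T , y∈T) = T , ∧-true⁺ c (∧-true⁺ x∈T y∈T)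
        ...   | inj₂ (T , b , x∈T , _) = true≢false (all-leaves {x} x∈S₁) (2≤⇒¬isOne (2≤Near-deg {x} a₁ x∈S₁ b x∈T))
          where
          x∈S₁ = subst (λ Z → x ∈ᵇ Z ≡ true) (Single⇒≡ {S} s) x∈S

        module OneCover = One.WithCover One-cover

        ∣V₀∣≡4 : OneCover.∣V₀∣ ≡ 4
        ∣V₀∣≡4 = trans (∑-cong (allFin n) touched⇔∈) (size-h (∧-conicalˡ _ _ a₁))
          where
          touched⇔∈ : ∀ x → 𝟙 (One.touched x) ≡ 𝟙 (x ∈ᵇ S₁)
          touched⇔∈ x rewrite One-deg x with x ∈ᵇ S₁
          ... | true  = refl
          ... | false = refl

        102≤credit : ∀ x → 102 * 𝟙 (x ∈ᵇ S₁) ≤ OneCover.credit x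
        102≤credit x with x ∈ᵇ S₁ in x∈S₁
        ... | false = z≤n
        ... | true  = ≤-trans (*-monoʳ-≤ 34 3≤oneSidedDeg) (OneCover.34*oneSidedDeg≤credit x)
          where
          3≤oneSidedDeg = One.leaf⇒3≤oneSidedDeg {x} {S₁} (trans (One-deg x) (𝟙-true x∈S₁)) (One.A⇒E {S₁} Single-S₁) x∈S₁

        charged : 168 * OneCover.∣V₀∣ ≤ 408 * e Single + ∑ᵥ OneCover.credit
        charged rewrite ∣V₀∣≡4 | allSubsets-once S₁ = +-monoʳ-≤ 408 (begin
          264                         ≤⟨ m≤m+n 264 144 ⟩
          102 * 4                     ≡⟨ cong (102 *_) (sym (size-h (∧-conicalˡ _ _ a₁))) ⟩
          102 * size S₁               ≡⟨ sym (∑-*ˡ (allFin n) 102 _) ⟩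
          ∑ᵥ (λ x → 102 * 𝟙 (x ∈ᵇ S₁)) ≤⟨ ∑-mono (allFin n) 102≤credit ⟩
          ∑ᵥ OneCover.credit          ∎)
          where open ≤-Reasoning

        dense : DenseSubhypergraph
        dense = OneCover.dense-subhypergraph {S₁} Single-S₁ charged

      dense-subhypergraph : (∃ λ S → h S ≢ g S) → e g ≤ e h → DenseSubhypergraph
      dense-subhypergraph differ eg≤eh with someSubset (λ S → onlyH S ∧ not (does (Near.leaves S ≤? 3))) in some
      ... | true with someSubset⁻ (λ S → onlyH S ∧ not (does (Near.leaves S ≤? 3))) some
      ...   | S₁ , p = Isolated.dense (∧-conicalˡ (onlyH S₁) _ p) all-leaves
        where
        all-leaves : ∀ {w} → w ∈ᵇ S₁ ≡ true → Near.leaf w ≡ true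
        all-leaves {w} w∈S₁ with Near.leaf w in l
        ... | true  = refl
        ... | false = true≢false (∧-conicalʳ (onlyH S₁) _ p) (cong not (dec-true (Near.leaves S₁ ≤? 3) leaves≤3))
          where
          leaves≤3 = Near.non-leaf⇒leaves≤3 (Near.A⇒E (∧-conicalˡ (onlyH S₁) _ p)) w∈S₁ l
      dense-subhypergraph differ eg≤eh | false = dense-if-no-isolated-edge (proj₂ (∃-onlyH differ eg≤eh)) hub-in-every eg≤eh
        where
        hub-in-every : ∀ {S} → onlyH S ≡ true → Near.leaves S ≤ 3
        hub-in-every {S} a with Near.leaves S ≤? 3
        ... | yes ≤3 = ≤3
        ... | no  ¬≤ = true≢false (someSubset⁺ _ S (∧-true⁺ a (cong not (dec-false (Near.leaves S ≤? 3) ¬≤)))) some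

module Rational where

  open import Data.Integer as ℤ using (+_; +[1+_]; -[1+_]; +≤+)
  import Data.Integer.Properties as ℤ
  open import Data.Nat as ℕ using (ℕ; suc)
  import Data.Nat.Properties as ℕ
  open import Data.Product using (Σ; _,_)
  open import Data.Rational using (mkℚ; _/_; _≤_; *≤*; _-_; 1/_; NonZero)
  open import Data.Rational.Properties using (toℚᵘ-cancel-≤; toℚᵘ-fromℚᵘ; neg-antimono-≤; +-monoʳ-≤)
  import Data.Rational.Unnormalised as ℚᵘ
  import Data.Rational.Unnormalised.Properties as ℚᵘ
  open import Relation.Binary.PropositionalEquality using (sym; subst₂)

  7/17≤a/b : ∀ a b (nz : ℕ.NonZero b) → 7 ℕ.* b ℕ.≤ 17 ℕ.* a → (+ 7) / 17 ≤ _/_ (+ a) b {{nz}}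
  7/17≤a/b a (suc b) _ 7b≤17a =
    toℚᵘ-cancel-≤ (ℚᵘ.≤-respʳ-≃ (ℚᵘ.≃-sym (toℚᵘ-fromℚᵘ (ℚᵘ.mkℚᵘ (+ a) b))) (ℚᵘ.*≤* cross))
    where
    cross : (+ 7) ℤ.* (+ suc b) ℤ.≤ (+ a) ℤ.* (+ 17)
    cross = subst₂ ℤ._≤_ (ℤ.pos-* 7 (suc b)) (ℤ.pos-* a 17) (+≤+ (ℕ.≤-trans 7b≤17a (ℕ.≤-reflexive (ℕ.*-comm 17 a))))

  7/17≤m⇒4/7≤3-1/m : ∀ m → (+ 7) / 17 ≤ m → Σ (NonZero m) λ nz → (+ 4) / 7 ≤ ((+ 4) / 1 - (+ 1) / 1) - 1/_ m {{nz}}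
  7/17≤m⇒4/7≤3-1/m (mkℚ +[1+ a ] d c) (*≤* 7d≤17a) =
    _ , +-monoʳ-≤ ((+ 4) / 1 - (+ 1) / 1) (neg-antimono-≤ 1/m≤17/7)
    where
    7d≤a17 : 7 ℕ.* suc d ℕ.≤ suc a ℕ.* 17
    7d≤a17 = ℤ.drop‿+≤+ (subst₂ ℤ._≤_ (sym (ℤ.pos-* 7 (suc d))) (sym (ℤ.pos-* (suc a) 17)) 7d≤17a)
    1/m≤17/7 : 1/ (mkℚ +[1+ a ] d c) ≤ (+ 17) / 7
    1/m≤17/7 = *≤* (subst₂ ℤ._≤_ (ℤ.pos-* (suc d) 7) (ℤ.pos-* 17 (suc a))
      (+≤+ (ℕ.≤-trans (ℕ.≤-reflexive (ℕ.*-comm (suc d) 7)) (ℕ.≤-trans 7d≤a17 (ℕ.≤-reflexive (ℕ.*-comm (suc a) 17))))))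
  7/17≤m⇒4/7≤3-1/m (mkℚ (+ 0) d c) (*≤* (+≤+ ()))
  7/17≤m⇒4/7≤3-1/m (mkℚ -[1+ a ] d c) (*≤* ())

open import Defs
open import Data.Nat using (ℕ)
open import Data.Product using (Σ; _×_; ∃)
open import Data.Rational using (ℚ; _≤_; _-_; 1/_; _/_; NonZero)
open import Data.Integer using (+_)
open import Relation.Binary.PropositionalEquality using (_≢_)
open import Data.Product using (_,_; proj₁; proj₂)
open import Data.Rational.Properties using (≤-trans)
open import Data.Fin.Subset using (∣_∣)

theorem35 : ∀ (n : ℕ) (h g : Hypergraph n) →
    Uniform 4 h → Uniform 4 g →
    (∃ λ S → h S ≢ g S) →
    SameProj h g →
    e g Data.Nat.≤ e h →
    ∀ (m : ℚ) → IsMaxDensity h m →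
    Σ (NonZero m) λ nz →
      (+ 4) / 7 ≤ ((+ 4) / 1 - (+ 1) / 1) - 1/_ m {{nz}}
theorem35 n h g h-uniform g-uniform differ same-proj eg≤eh m (_ , maximal) =
  7/17≤m⇒4/7≤3-1/m m (≤-trans 7/17≤density (maximal K))
  where
  open Rational
  open Combinatorics.TwoHypergraphs h g h-uniform g-uniform
  dense : DenseSubhypergraph
  dense = WithSameProj.dense-subhypergraph same-proj differ eg≤eh
  K : SubHypergraph h
  K = proj₁ dense
  7/17≤density : (+ 7) / 17 ≤ density K
  7/17≤density = 7/17≤a/b (e (SubHypergraph.F K)) ∣ SubHypergraph.U K ∣ (SubHypergraph.U-nonempty K) (proj₂ dense)
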